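{- If $q\in\{16,17,\dots,40\}$, then $\operatorname{achr}(K_6\square K_q)\ge 2q+4$.
   Context: For a finite simple graph $G$, $\operatorname{achr}(G)$ (the achromatic number) is the maximum number of colours in a proper vertex colouring of $G$ that is complete, i.e. every pair of distinct colours appears on the two ends of some edge. $K_6\square K_q$ is the Cartesian product of the complete graphs $K_6$ and $K_q$ (vertex set $[1,6]\times[1,q]$, two vertices adjacent iff they agree in exactly one coordinate). -}

module Defs where

open import Data.Nat using (ℕ; _≤_)
open import Data.Fin using (Fin)
open import Data.Product using (Σ; ∃; ∃-syntax; _×_; _,_; proj₁; proj₂)
open import Data.Sum using (_⊎_; inj₁; inj₂)
open import Relation.Nullary using (¬_)
open import Relation.Binary.PropositionalEquality using (_≡_; _≢_; refl; sym)

record Graph : Set₁ where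
  field
    V      : Set
    Adj    : V → V → Set
    Adj-sym    : ∀ {u v} → Adj u v → Adj v u
    Adj-irrefl : ∀ {u} → ¬ Adj u u
open Graph public

Proper : (G : Graph) (k : ℕ) → (V G → Fin k) → Set
Proper G k c = ∀ u v → Adj G u v → c u ≢ c v

Complete : (G : Graph) (k : ℕ) → (V G → Fin k) → Set
Complete G k c = ∀ (i j : Fin k) → i ≢ j →
  ∃[ u ] ∃[ v ] (Adj G u v × c u ≡ i × c v ≡ j)

HasCompleteColouring : Graph → ℕ → Set
HasCompleteColouring G k =
  ∃[ c ] (Proper G k c × Complete G k c × (∀ (i : Fin k) → ∃[ u ] c u ≡ i))

AchrAtLeast : Graph → ℕ → Set
AchrAtLeast G m = ∃[ k ] (m ≤ k × HasCompleteColouring G k)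

-- K_p □ K_q : vertices Fin p × Fin q, adjacent iff they agree in exactly one coordinate.
KAdj : (p q : ℕ) → Fin p × Fin q → Fin p × Fin q → Set
KAdj p q (a , b) (a' , b') = (a ≡ a' × b ≢ b') ⊎ (a ≢ a' × b ≡ b')

KAdj-sym : (p q : ℕ) → ∀ {u v} → KAdj p q u v → KAdj p q v u
KAdj-sym p q (inj₁ (e , ne)) = inj₁ (sym e , λ x → ne (sym x))
KAdj-sym p q (inj₂ (ne , e)) = inj₂ ((λ x → ne (sym x)) , sym e)

KAdj-irrefl : (p q : ℕ) → ∀ {u} → ¬ KAdj p q u u
KAdj-irrefl p q (inj₁ (_ , ne)) = ne refl
KAdj-irrefl p q (inj₂ (ne , _)) = ne refl

KK : ℕ → ℕ → Graph
KK p q = record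
  { V = Fin p × Fin q
  ; Adj = KAdj p q
  ; Adj-sym = KAdj-sym p q
  ; Adj-irrefl = KAdj-irrefl p q
  }

-- The colourings are given explicitly, one 6 × q table of colours for each q.  A colouring is
-- proper and complete exactly when its colour classes are independent and any two of them are
-- joined by an edge; with at least two colours, completeness already forces every colour to be
-- used.  Grouping the 6q vertices by colour thus turns each case into a small finite check,
-- decided by evaluation.

module Submission where

open import Defs
open import Data.Nat using (ℕ; _≤_; _<_; _+_; _*_; s≤s)
open import Data.Nat.Properties using (≤-refl; m+[n∸m]≡n; m+n∸m≡n; ∸-monoˡ-<)
open import Data.Fin as Fin using (Fin; zero; suc; #_; punchIn)
open import Data.Fin.Properties using (_≟_; <-cmp; punchInᵢ≢i)
open import Data.Vec using (Vec; []; _∷_; lookup; updateAt; replicate)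
open import Data.Vec.Properties using (lookup-replicate; lookup∘updateAt; lookup∘updateAt′)
import Data.Vec.Relation.Unary.All as VecAll
open import Data.Vec.Relation.Unary.All.Properties using (lookup⁺)
open import Data.Vec.Relation.Unary.AllPairs using (AllPairs; _∷_; allPairs?)
open import Data.List using (List; []; _∷_; foldr; allFin; cartesianProduct; applyUpTo)
open import Data.List.Relation.Unary.All as All using (All; all?; []; _∷_)
open import Data.List.Relation.Unary.Any using (Any; any?; here; there)
open import Data.List.Membership.Propositional using (_∈_; find)
open import Data.List.Membership.Propositional.Properties using (∈-cartesianProduct⁺; ∈-allFin; ∈-applyUpTo⁺)
open import Data.Product using (_×_; _,_; proj₁; proj₂; ∃-syntax)
open import Relation.Nullary using (¬_; Dec; yes; no; contradiction)
open import Relation.Nullary.Decidable using (True; toWitness; _×-dec_; _⊎-dec_; ¬?)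
open import Relation.Binary using (tri<; tri≈; tri>)
open import Relation.Binary.PropositionalEquality using (_≡_; refl; sym; subst; ≢-sym)

module _ {A : Set} {k : ℕ} (f : A → Fin k) where

  -- A single pass over the list, so that a check evaluating the fibres builds each one once.
  fibres : List A → Vec (List A) k
  fibres = foldr (λ x W → updateAt W (f x) (x ∷_)) (replicate k [])

  ∈-fibres⁻ : ∀ xs {x i} → x ∈ lookup (fibres xs) i → f x ≡ i
  ∈-fibres⁻ [] {i = i} x∈ with () ← subst (_ ∈_) (lookup-replicate i []) x∈
  ∈-fibres⁻ (y ∷ xs) {x} {i} x∈ with f y ≟ i
  ... | yes refl with subst (x ∈_) (lookup∘updateAt (f y) (fibres xs)) x∈
  ...   | here refl = refl
  ...   | there x∈′ = ∈-fibres⁻ xs x∈′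
  ∈-fibres⁻ (y ∷ xs) {x} {i} x∈ | no fy≢i =
    ∈-fibres⁻ xs (subst (x ∈_) (lookup∘updateAt′ i (f y) (≢-sym fy≢i) (fibres xs)) x∈)

  ∈-fibres⁺ : ∀ {xs x i} → x ∈ xs → f x ≡ i → x ∈ lookup (fibres xs) i
  ∈-fibres⁺ {y ∷ xs} {x} {i} x∈ fx≡i with f y ≟ i | x∈
  ... | yes refl | here x≡y  = subst (x ∈_) (sym (lookup∘updateAt (f y) (fibres xs))) (here x≡y)
  ... | yes refl | there x∈′ =
    subst (x ∈_) (sym (lookup∘updateAt (f y) (fibres xs))) (there (∈-fibres⁺ x∈′ fx≡i))
  ... | no fy≢i  | here refl = contradiction fx≡i fy≢i
  ... | no fy≢i  | there x∈′ =
    subst (x ∈_) (sym (lookup∘updateAt′ i (f y) (≢-sym fy≢i) (fibres xs))) (∈-fibres⁺ x∈′ fx≡i)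

∈-applyUpTo-+ : ∀ {m n q} → m ≤ q → q < m + n → q ∈ applyUpTo (m +_) n
∈-applyUpTo-+ {m} {n} m≤q q<m+n =
  subst (_∈ _) (m+[n∸m]≡n m≤q) (∈-applyUpTo⁺ (m +_) (subst (_ <_) (m+n∸m≡n m n) (∸-monoˡ-< q<m+n m≤q)))

allPairs-lookup : ∀ {A : Set} {R : A → A → Set} {n} {xs : Vec A n} →
                  AllPairs R xs → ∀ {i j} → i Fin.< j → R (lookup xs i) (lookup xs j)
allPairs-lookup (Rx ∷ _)  {zero}  {suc j} _         = lookup⁺ Rx j
allPairs-lookup (_ ∷ Rxs) {suc i} {suc j} (s≤s i<j) = allPairs-lookup Rxs i<j

module _ (G : Graph) where

  Independent : List (V G) → Set
  Independent C = All (λ u → All (λ v → ¬ Adj G u v) C) C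

  Joined : List (V G) → List (V G) → Set
  Joined C D = Any (λ u → Any (Adj G u) D) C

  joined⇒edge : ∀ {C D} → Joined C D → ∃[ u ] ∃[ v ] (u ∈ C × v ∈ D × Adj G u v)
  joined⇒edge J = let u , u∈ , Ju = find J ; v , v∈ , uv = find Ju in u , v , u∈ , v∈ , uv

  CompleteClasses : ∀ {k} → Vec (List (V G)) k → Set
  CompleteClasses W = VecAll.All Independent W × AllPairs Joined W

  completeClasses? : (∀ u v → Dec (Adj G u v)) → ∀ {k} (W : Vec (List (V G)) k) → Dec (CompleteClasses W)
  completeClasses? adj? W = VecAll.all? independent? W ×-dec allPairs? joined? W
    where
    independent? : ∀ C → Dec (Independent C)
    independent? C = all? (λ u → all? (λ v → ¬? (adj? u v)) C) C
    joined? : ∀ C D → Dec (Joined C D)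
    joined? C D = any? (λ u → any? (adj? u) D) C

  module _ {k : ℕ} (c : V G → Fin k) (W : Vec (List (V G)) k)
           (∈-class⁺ : ∀ u → u ∈ lookup W (c u))
           (∈-class⁻ : ∀ {u i} → u ∈ lookup W i → c u ≡ i) where

    independent⇒proper : VecAll.All Independent W → Proper G k c
    independent⇒proper indep u v uv cu≡cv =
      All.lookup (All.lookup (lookup⁺ indep (c u)) (∈-class⁺ u))
                 (subst (λ i → v ∈ lookup W i) (sym cu≡cv) (∈-class⁺ v)) uv

    edge-between : AllPairs Joined W → ∀ {i j} → i Fin.< j → ∃[ u ] ∃[ v ] (Adj G u v × c u ≡ i × c v ≡ j)
    edge-between joined i<j with u , v , u∈ , v∈ , uv ← joined⇒edge (allPairs-lookup joined i<j) =
      u , v , uv , ∈-class⁻ u∈ , ∈-class⁻ v∈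

    joined⇒complete : AllPairs Joined W → Complete G k c
    joined⇒complete joined i j i≢j with <-cmp i j
    ... | tri< i<j _ _ = edge-between joined i<j
    ... | tri≈ _ i≡j _ = contradiction i≡j i≢j
    ... | tri> _ _ j<i with u , v , uv , cu≡j , cv≡i ← edge-between joined j<i =
      v , u , Adj-sym G uv , cv≡i , cu≡j

  complete⇒surjective : ∀ {k} {c : V G → Fin (2 + k)} → Complete G (2 + k) c → ∀ i → ∃[ u ] c u ≡ i
  complete⇒surjective complete i
    with u , _ , _ , cu≡i , _ ← complete i (punchIn i zero) (≢-sym (punchInᵢ≢i i zero)) = u , cu≡i

Table : ℕ → ℕ → ℕ → Set
Table p q k = Vec (Vec (Fin k) q) p

module _ {p q : ℕ} where

  tableColouring : ∀ {k} → Table p q k → Fin p × Fin q → Fin k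
  tableColouring t (a , b) = lookup (lookup t a) b

  vertices : List (Fin p × Fin q)
  vertices = cartesianProduct (allFin p) (allFin q)

  ∈-vertices : ∀ u → u ∈ vertices
  ∈-vertices (a , b) = ∈-cartesianProduct⁺ (∈-allFin a) (∈-allFin b)

  kadj? : ∀ u v → Dec (KAdj p q u v)
  kadj? (a , b) (a′ , b′) = (a ≟ a′ ×-dec ¬? (b ≟ b′)) ⊎-dec (¬? (a ≟ a′) ×-dec b ≟ b′)

  classes : ∀ {k} → Table p q k → Vec (List (Fin p × Fin q)) k
  classes t = fibres (tableColouring t) vertices

  table⇒hasCompleteColouring : ∀ {k} (t : Table p q (2 + k)) →
                               True (completeClasses? (KK p q) kadj? (classes t)) →
                               HasCompleteColouring (KK p q) (2 + k)
  table⇒hasCompleteColouring {k} t ok = c , proper , complete , complete⇒surjective (KK p q) complete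
    where
    c : Fin p × Fin q → Fin (2 + k)
    c = tableColouring t
    ∈-class⁺ : ∀ u → u ∈ lookup (classes t) (c u)
    ∈-class⁺ u = ∈-fibres⁺ c (∈-vertices u) refl
    proper : Proper (KK p q) (2 + k) c
    proper = independent⇒proper (KK p q) c (classes t) ∈-class⁺ (∈-fibres⁻ c vertices) (proj₁ (toWitness ok))
    complete : Complete (KK p q) (2 + k) c
    complete = joined⇒complete (KK p q) c (classes t) ∈-class⁺ (∈-fibres⁻ c vertices) (proj₂ (toWitness ok))

table16 : Table 6 16 36
table16 =
    (# 0 ∷ # 1 ∷ # 2 ∷ # 3 ∷ # 12 ∷ # 14 ∷ # 13 ∷ # 20 ∷ # 18 ∷ # 19 ∷ # 25 ∷ # 26 ∷ # 24 ∷ # 30 ∷ # 32 ∷ # 31 ∷ [])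
  ∷ (# 1 ∷ # 0 ∷ # 3 ∷ # 2 ∷ # 17 ∷ # 16 ∷ # 15 ∷ # 23 ∷ # 21 ∷ # 22 ∷ # 29 ∷ # 28 ∷ # 27 ∷ # 35 ∷ # 33 ∷ # 34 ∷ [])
  ∷ (# 4 ∷ # 5 ∷ # 6 ∷ # 7 ∷ # 13 ∷ # 12 ∷ # 14 ∷ # 18 ∷ # 19 ∷ # 20 ∷ # 28 ∷ # 27 ∷ # 29 ∷ # 33 ∷ # 34 ∷ # 35 ∷ [])
  ∷ (# 6 ∷ # 7 ∷ # 4 ∷ # 5 ∷ # 15 ∷ # 17 ∷ # 16 ∷ # 22 ∷ # 23 ∷ # 21 ∷ # 24 ∷ # 25 ∷ # 26 ∷ # 32 ∷ # 31 ∷ # 30 ∷ [])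
  ∷ (# 8 ∷ # 9 ∷ # 10 ∷ # 11 ∷ # 14 ∷ # 13 ∷ # 12 ∷ # 21 ∷ # 22 ∷ # 23 ∷ # 26 ∷ # 24 ∷ # 25 ∷ # 34 ∷ # 35 ∷ # 33 ∷ [])
  ∷ (# 11 ∷ # 10 ∷ # 9 ∷ # 8 ∷ # 16 ∷ # 15 ∷ # 17 ∷ # 19 ∷ # 20 ∷ # 18 ∷ # 27 ∷ # 29 ∷ # 28 ∷ # 31 ∷ # 30 ∷ # 32 ∷ [])
  ∷ []

colouring16 : HasCompleteColouring (KK 6 16) 36
colouring16 = table⇒hasCompleteColouring table16 _

table17 : Table 6 17 38
table17 =
    (# 0 ∷ # 1 ∷ # 2 ∷ # 3 ∷ # 12 ∷ # 13 ∷ # 14 ∷ # 15 ∷ # 21 ∷ # 20 ∷ # 22 ∷ # 28 ∷ # 27 ∷ # 26 ∷ # 34 ∷ # 33 ∷ # 32 ∷ [])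
  ∷ (# 1 ∷ # 0 ∷ # 3 ∷ # 2 ∷ # 17 ∷ # 16 ∷ # 19 ∷ # 18 ∷ # 24 ∷ # 23 ∷ # 25 ∷ # 31 ∷ # 30 ∷ # 29 ∷ # 35 ∷ # 36 ∷ # 37 ∷ [])
  ∷ (# 4 ∷ # 5 ∷ # 6 ∷ # 7 ∷ # 13 ∷ # 15 ∷ # 12 ∷ # 14 ∷ # 22 ∷ # 21 ∷ # 20 ∷ # 29 ∷ # 31 ∷ # 30 ∷ # 37 ∷ # 35 ∷ # 36 ∷ [])
  ∷ (# 6 ∷ # 7 ∷ # 4 ∷ # 5 ∷ # 18 ∷ # 19 ∷ # 16 ∷ # 17 ∷ # 23 ∷ # 25 ∷ # 24 ∷ # 26 ∷ # 28 ∷ # 27 ∷ # 32 ∷ # 34 ∷ # 33 ∷ [])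
  ∷ (# 8 ∷ # 9 ∷ # 10 ∷ # 11 ∷ # 14 ∷ # 12 ∷ # 15 ∷ # 13 ∷ # 25 ∷ # 24 ∷ # 23 ∷ # 27 ∷ # 26 ∷ # 28 ∷ # 36 ∷ # 37 ∷ # 35 ∷ [])
  ∷ (# 11 ∷ # 10 ∷ # 9 ∷ # 8 ∷ # 16 ∷ # 18 ∷ # 17 ∷ # 19 ∷ # 20 ∷ # 22 ∷ # 21 ∷ # 30 ∷ # 29 ∷ # 31 ∷ # 33 ∷ # 32 ∷ # 34 ∷ [])
  ∷ []

colouring17 : HasCompleteColouring (KK 6 17) 38
colouring17 = table⇒hasCompleteColouring table17 _

table18 : Table 6 18 40
table18 =
    (# 0 ∷ # 1 ∷ # 2 ∷ # 3 ∷ # 13 ∷ # 15 ∷ # 14 ∷ # 12 ∷ # 20 ∷ # 22 ∷ # 23 ∷ # 21 ∷ # 28 ∷ # 29 ∷ # 30 ∷ # 35 ∷ # 34 ∷ # 36 ∷ [])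
  ∷ (# 1 ∷ # 0 ∷ # 3 ∷ # 2 ∷ # 18 ∷ # 17 ∷ # 19 ∷ # 16 ∷ # 25 ∷ # 24 ∷ # 26 ∷ # 27 ∷ # 31 ∷ # 32 ∷ # 33 ∷ # 39 ∷ # 37 ∷ # 38 ∷ [])
  ∷ (# 4 ∷ # 5 ∷ # 6 ∷ # 7 ∷ # 12 ∷ # 14 ∷ # 15 ∷ # 13 ∷ # 21 ∷ # 23 ∷ # 22 ∷ # 20 ∷ # 32 ∷ # 33 ∷ # 31 ∷ # 38 ∷ # 39 ∷ # 37 ∷ [])
  ∷ (# 6 ∷ # 7 ∷ # 4 ∷ # 5 ∷ # 17 ∷ # 18 ∷ # 16 ∷ # 19 ∷ # 26 ∷ # 25 ∷ # 27 ∷ # 24 ∷ # 30 ∷ # 28 ∷ # 29 ∷ # 34 ∷ # 36 ∷ # 35 ∷ [])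
  ∷ (# 8 ∷ # 9 ∷ # 10 ∷ # 11 ∷ # 15 ∷ # 12 ∷ # 13 ∷ # 14 ∷ # 27 ∷ # 26 ∷ # 24 ∷ # 25 ∷ # 29 ∷ # 30 ∷ # 28 ∷ # 37 ∷ # 38 ∷ # 39 ∷ [])
  ∷ (# 11 ∷ # 10 ∷ # 9 ∷ # 8 ∷ # 19 ∷ # 16 ∷ # 18 ∷ # 17 ∷ # 23 ∷ # 20 ∷ # 21 ∷ # 22 ∷ # 33 ∷ # 31 ∷ # 32 ∷ # 36 ∷ # 35 ∷ # 34 ∷ [])
  ∷ []

colouring18 : HasCompleteColouring (KK 6 18) 40
colouring18 = table⇒hasCompleteColouring table18 _

table19 : Table 6 19 42
table19 =
    (# 0 ∷ # 1 ∷ # 2 ∷ # 3 ∷ # 13 ∷ # 12 ∷ # 14 ∷ # 15 ∷ # 23 ∷ # 22 ∷ # 20 ∷ # 21 ∷ # 29 ∷ # 30 ∷ # 31 ∷ # 28 ∷ # 36 ∷ # 37 ∷ # 38 ∷ [])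
  ∷ (# 1 ∷ # 0 ∷ # 3 ∷ # 2 ∷ # 18 ∷ # 17 ∷ # 19 ∷ # 16 ∷ # 24 ∷ # 27 ∷ # 25 ∷ # 26 ∷ # 35 ∷ # 33 ∷ # 34 ∷ # 32 ∷ # 41 ∷ # 40 ∷ # 39 ∷ [])
  ∷ (# 4 ∷ # 5 ∷ # 6 ∷ # 7 ∷ # 15 ∷ # 14 ∷ # 12 ∷ # 13 ∷ # 21 ∷ # 20 ∷ # 22 ∷ # 23 ∷ # 32 ∷ # 35 ∷ # 33 ∷ # 34 ∷ # 40 ∷ # 39 ∷ # 41 ∷ [])
  ∷ (# 6 ∷ # 7 ∷ # 4 ∷ # 5 ∷ # 19 ∷ # 16 ∷ # 17 ∷ # 18 ∷ # 26 ∷ # 25 ∷ # 27 ∷ # 24 ∷ # 31 ∷ # 28 ∷ # 30 ∷ # 29 ∷ # 38 ∷ # 36 ∷ # 37 ∷ [])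
  ∷ (# 8 ∷ # 9 ∷ # 10 ∷ # 11 ∷ # 14 ∷ # 13 ∷ # 15 ∷ # 12 ∷ # 27 ∷ # 24 ∷ # 26 ∷ # 25 ∷ # 30 ∷ # 29 ∷ # 28 ∷ # 31 ∷ # 39 ∷ # 41 ∷ # 40 ∷ [])
  ∷ (# 11 ∷ # 10 ∷ # 9 ∷ # 8 ∷ # 16 ∷ # 19 ∷ # 18 ∷ # 17 ∷ # 22 ∷ # 21 ∷ # 23 ∷ # 20 ∷ # 34 ∷ # 32 ∷ # 35 ∷ # 33 ∷ # 37 ∷ # 38 ∷ # 36 ∷ [])
  ∷ []

colouring19 : HasCompleteColouring (KK 6 19) 42
colouring19 = table⇒hasCompleteColouring table19 _

table20 : Table 6 20 44
table20 =
    (# 0 ∷ # 1 ∷ # 2 ∷ # 3 ∷ # 15 ∷ # 13 ∷ # 12 ∷ # 14 ∷ # 21 ∷ # 23 ∷ # 22 ∷ # 20 ∷ # 29 ∷ # 30 ∷ # 31 ∷ # 28 ∷ # 37 ∷ # 39 ∷ # 38 ∷ # 36 ∷ [])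
  ∷ (# 1 ∷ # 0 ∷ # 3 ∷ # 2 ∷ # 16 ∷ # 17 ∷ # 18 ∷ # 19 ∷ # 25 ∷ # 24 ∷ # 26 ∷ # 27 ∷ # 32 ∷ # 33 ∷ # 34 ∷ # 35 ∷ # 43 ∷ # 42 ∷ # 40 ∷ # 41 ∷ [])
  ∷ (# 4 ∷ # 5 ∷ # 6 ∷ # 7 ∷ # 12 ∷ # 14 ∷ # 15 ∷ # 13 ∷ # 23 ∷ # 21 ∷ # 20 ∷ # 22 ∷ # 35 ∷ # 34 ∷ # 32 ∷ # 33 ∷ # 41 ∷ # 40 ∷ # 42 ∷ # 43 ∷ [])
  ∷ (# 6 ∷ # 7 ∷ # 4 ∷ # 5 ∷ # 17 ∷ # 16 ∷ # 19 ∷ # 18 ∷ # 24 ∷ # 26 ∷ # 27 ∷ # 25 ∷ # 31 ∷ # 29 ∷ # 28 ∷ # 30 ∷ # 39 ∷ # 37 ∷ # 36 ∷ # 38 ∷ [])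
  ∷ (# 8 ∷ # 9 ∷ # 10 ∷ # 11 ∷ # 13 ∷ # 15 ∷ # 14 ∷ # 12 ∷ # 27 ∷ # 25 ∷ # 24 ∷ # 26 ∷ # 28 ∷ # 31 ∷ # 30 ∷ # 29 ∷ # 40 ∷ # 41 ∷ # 43 ∷ # 42 ∷ [])
  ∷ (# 11 ∷ # 10 ∷ # 9 ∷ # 8 ∷ # 19 ∷ # 18 ∷ # 16 ∷ # 17 ∷ # 20 ∷ # 22 ∷ # 23 ∷ # 21 ∷ # 33 ∷ # 32 ∷ # 35 ∷ # 34 ∷ # 36 ∷ # 38 ∷ # 39 ∷ # 37 ∷ [])
  ∷ []

colouring20 : HasCompleteColouring (KK 6 20) 44
colouring20 = table⇒hasCompleteColouring table20 _

table21 : Table 6 21 46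
table21 =
    (# 0 ∷ # 1 ∷ # 2 ∷ # 3 ∷ # 13 ∷ # 16 ∷ # 12 ∷ # 14 ∷ # 15 ∷ # 23 ∷ # 24 ∷ # 25 ∷ # 22 ∷ # 30 ∷ # 32 ∷ # 33 ∷ # 31 ∷ # 39 ∷ # 40 ∷ # 41 ∷
     # 38 ∷ [])
  ∷ (# 1 ∷ # 0 ∷ # 3 ∷ # 2 ∷ # 20 ∷ # 17 ∷ # 18 ∷ # 19 ∷ # 21 ∷ # 29 ∷ # 27 ∷ # 26 ∷ # 28 ∷ # 36 ∷ # 35 ∷ # 37 ∷ # 34 ∷ # 43 ∷ # 44 ∷ # 45 ∷
     # 42 ∷ [])
  ∷ (# 4 ∷ # 5 ∷ # 6 ∷ # 7 ∷ # 14 ∷ # 12 ∷ # 15 ∷ # 13 ∷ # 16 ∷ # 25 ∷ # 22 ∷ # 23 ∷ # 24 ∷ # 37 ∷ # 34 ∷ # 35 ∷ # 36 ∷ # 44 ∷ # 42 ∷ # 43 ∷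
     # 45 ∷ [])
  ∷ (# 6 ∷ # 7 ∷ # 4 ∷ # 5 ∷ # 19 ∷ # 21 ∷ # 17 ∷ # 20 ∷ # 18 ∷ # 28 ∷ # 26 ∷ # 27 ∷ # 29 ∷ # 31 ∷ # 33 ∷ # 32 ∷ # 30 ∷ # 38 ∷ # 41 ∷ # 40 ∷
     # 39 ∷ [])
  ∷ (# 8 ∷ # 9 ∷ # 10 ∷ # 11 ∷ # 16 ∷ # 15 ∷ # 13 ∷ # 12 ∷ # 14 ∷ # 27 ∷ # 28 ∷ # 29 ∷ # 26 ∷ # 33 ∷ # 30 ∷ # 31 ∷ # 32 ∷ # 45 ∷ # 43 ∷ # 42 ∷
     # 44 ∷ [])
  ∷ (# 11 ∷ # 10 ∷ # 9 ∷ # 8 ∷ # 17 ∷ # 19 ∷ # 21 ∷ # 18 ∷ # 20 ∷ # 22 ∷ # 25 ∷ # 24 ∷ # 23 ∷ # 35 ∷ # 36 ∷ # 34 ∷ # 37 ∷ # 41 ∷ # 38 ∷ # 39 ∷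
     # 40 ∷ [])
  ∷ []

colouring21 : HasCompleteColouring (KK 6 21) 46
colouring21 = table⇒hasCompleteColouring table21 _

table22 : Table 6 22 48
table22 =
    (# 0 ∷ # 1 ∷ # 2 ∷ # 3 ∷ # 13 ∷ # 16 ∷ # 12 ∷ # 14 ∷ # 15 ∷ # 23 ∷ # 25 ∷ # 26 ∷ # 22 ∷ # 24 ∷ # 35 ∷ # 32 ∷ # 34 ∷ # 33 ∷ # 43 ∷ # 42 ∷
     # 41 ∷ # 40 ∷ [])
  ∷ (# 1 ∷ # 0 ∷ # 3 ∷ # 2 ∷ # 19 ∷ # 21 ∷ # 18 ∷ # 17 ∷ # 20 ∷ # 29 ∷ # 31 ∷ # 28 ∷ # 27 ∷ # 30 ∷ # 39 ∷ # 36 ∷ # 37 ∷ # 38 ∷ # 45 ∷ # 44 ∷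
     # 47 ∷ # 46 ∷ [])
  ∷ (# 4 ∷ # 5 ∷ # 6 ∷ # 7 ∷ # 12 ∷ # 15 ∷ # 16 ∷ # 13 ∷ # 14 ∷ # 25 ∷ # 23 ∷ # 22 ∷ # 24 ∷ # 26 ∷ # 36 ∷ # 37 ∷ # 38 ∷ # 39 ∷ # 47 ∷ # 46 ∷
     # 45 ∷ # 44 ∷ [])
  ∷ (# 6 ∷ # 7 ∷ # 4 ∷ # 5 ∷ # 17 ∷ # 19 ∷ # 20 ∷ # 21 ∷ # 18 ∷ # 31 ∷ # 29 ∷ # 30 ∷ # 28 ∷ # 27 ∷ # 32 ∷ # 35 ∷ # 33 ∷ # 34 ∷ # 40 ∷ # 43 ∷
     # 42 ∷ # 41 ∷ [])
  ∷ (# 8 ∷ # 9 ∷ # 10 ∷ # 11 ∷ # 15 ∷ # 13 ∷ # 14 ∷ # 12 ∷ # 16 ∷ # 27 ∷ # 30 ∷ # 29 ∷ # 31 ∷ # 28 ∷ # 33 ∷ # 34 ∷ # 35 ∷ # 32 ∷ # 44 ∷ # 45 ∷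
     # 46 ∷ # 47 ∷ [])
  ∷ (# 11 ∷ # 10 ∷ # 9 ∷ # 8 ∷ # 21 ∷ # 20 ∷ # 19 ∷ # 18 ∷ # 17 ∷ # 22 ∷ # 26 ∷ # 24 ∷ # 23 ∷ # 25 ∷ # 37 ∷ # 38 ∷ # 39 ∷ # 36 ∷ # 41 ∷ # 40 ∷
     # 43 ∷ # 42 ∷ [])
  ∷ []

colouring22 : HasCompleteColouring (KK 6 22) 48
colouring22 = table⇒hasCompleteColouring table22 _

table23 : Table 6 23 50
table23 =
    (# 0 ∷ # 1 ∷ # 2 ∷ # 3 ∷ # 14 ∷ # 16 ∷ # 12 ∷ # 13 ∷ # 15 ∷ # 26 ∷ # 25 ∷ # 22 ∷ # 23 ∷ # 24 ∷ # 36 ∷ # 35 ∷ # 32 ∷ # 33 ∷ # 34 ∷ # 42 ∷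
     # 44 ∷ # 43 ∷ # 45 ∷ [])
  ∷ (# 1 ∷ # 0 ∷ # 3 ∷ # 2 ∷ # 18 ∷ # 21 ∷ # 20 ∷ # 17 ∷ # 19 ∷ # 28 ∷ # 31 ∷ # 30 ∷ # 27 ∷ # 29 ∷ # 38 ∷ # 37 ∷ # 39 ∷ # 41 ∷ # 40 ∷ # 48 ∷
     # 46 ∷ # 49 ∷ # 47 ∷ [])
  ∷ (# 4 ∷ # 5 ∷ # 6 ∷ # 7 ∷ # 16 ∷ # 13 ∷ # 15 ∷ # 14 ∷ # 12 ∷ # 24 ∷ # 23 ∷ # 26 ∷ # 22 ∷ # 25 ∷ # 37 ∷ # 41 ∷ # 40 ∷ # 39 ∷ # 38 ∷ # 46 ∷
     # 49 ∷ # 47 ∷ # 48 ∷ [])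
  ∷ (# 6 ∷ # 7 ∷ # 4 ∷ # 5 ∷ # 21 ∷ # 17 ∷ # 18 ∷ # 19 ∷ # 20 ∷ # 31 ∷ # 27 ∷ # 28 ∷ # 29 ∷ # 30 ∷ # 34 ∷ # 33 ∷ # 36 ∷ # 32 ∷ # 35 ∷ # 44 ∷
     # 42 ∷ # 45 ∷ # 43 ∷ [])
  ∷ (# 8 ∷ # 9 ∷ # 10 ∷ # 11 ∷ # 13 ∷ # 15 ∷ # 16 ∷ # 12 ∷ # 14 ∷ # 27 ∷ # 30 ∷ # 29 ∷ # 31 ∷ # 28 ∷ # 33 ∷ # 36 ∷ # 35 ∷ # 34 ∷ # 32 ∷ # 49 ∷
     # 47 ∷ # 48 ∷ # 46 ∷ [])
  ∷ (# 11 ∷ # 10 ∷ # 9 ∷ # 8 ∷ # 17 ∷ # 20 ∷ # 19 ∷ # 21 ∷ # 18 ∷ # 23 ∷ # 26 ∷ # 25 ∷ # 24 ∷ # 22 ∷ # 41 ∷ # 40 ∷ # 38 ∷ # 37 ∷ # 39 ∷ # 45 ∷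
     # 43 ∷ # 44 ∷ # 42 ∷ [])
  ∷ []

colouring23 : HasCompleteColouring (KK 6 23) 50
colouring23 = table⇒hasCompleteColouring table23 _

table24 : Table 6 24 52
table24 =
    (# 0 ∷ # 1 ∷ # 2 ∷ # 3 ∷ # 16 ∷ # 12 ∷ # 15 ∷ # 13 ∷ # 14 ∷ # 26 ∷ # 24 ∷ # 23 ∷ # 22 ∷ # 25 ∷ # 35 ∷ # 32 ∷ # 33 ∷ # 36 ∷ # 34 ∷ # 44 ∷
     # 43 ∷ # 46 ∷ # 42 ∷ # 45 ∷ [])
  ∷ (# 1 ∷ # 0 ∷ # 3 ∷ # 2 ∷ # 18 ∷ # 21 ∷ # 17 ∷ # 19 ∷ # 20 ∷ # 31 ∷ # 29 ∷ # 30 ∷ # 27 ∷ # 28 ∷ # 39 ∷ # 41 ∷ # 37 ∷ # 40 ∷ # 38 ∷ # 49 ∷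
     # 51 ∷ # 47 ∷ # 50 ∷ # 48 ∷ [])
  ∷ (# 4 ∷ # 5 ∷ # 6 ∷ # 7 ∷ # 14 ∷ # 13 ∷ # 16 ∷ # 12 ∷ # 15 ∷ # 24 ∷ # 23 ∷ # 25 ∷ # 26 ∷ # 22 ∷ # 41 ∷ # 39 ∷ # 38 ∷ # 37 ∷ # 40 ∷ # 48 ∷
     # 49 ∷ # 50 ∷ # 47 ∷ # 51 ∷ [])
  ∷ (# 6 ∷ # 7 ∷ # 4 ∷ # 5 ∷ # 19 ∷ # 17 ∷ # 18 ∷ # 20 ∷ # 21 ∷ # 29 ∷ # 27 ∷ # 28 ∷ # 30 ∷ # 31 ∷ # 36 ∷ # 34 ∷ # 35 ∷ # 33 ∷ # 32 ∷ # 45 ∷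
     # 44 ∷ # 43 ∷ # 46 ∷ # 42 ∷ [])
  ∷ (# 8 ∷ # 9 ∷ # 10 ∷ # 11 ∷ # 15 ∷ # 14 ∷ # 13 ∷ # 16 ∷ # 12 ∷ # 28 ∷ # 31 ∷ # 27 ∷ # 29 ∷ # 30 ∷ # 34 ∷ # 33 ∷ # 36 ∷ # 32 ∷ # 35 ∷ # 51 ∷
     # 47 ∷ # 48 ∷ # 49 ∷ # 50 ∷ [])
  ∷ (# 11 ∷ # 10 ∷ # 9 ∷ # 8 ∷ # 21 ∷ # 19 ∷ # 20 ∷ # 17 ∷ # 18 ∷ # 25 ∷ # 22 ∷ # 26 ∷ # 23 ∷ # 24 ∷ # 38 ∷ # 37 ∷ # 40 ∷ # 39 ∷ # 41 ∷ # 46 ∷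
     # 42 ∷ # 45 ∷ # 43 ∷ # 44 ∷ [])
  ∷ []

colouring24 : HasCompleteColouring (KK 6 24) 52
colouring24 = table⇒hasCompleteColouring table24 _

table25 : Table 6 25 54
table25 =
    (# 0 ∷ # 1 ∷ # 2 ∷ # 3 ∷ # 15 ∷ # 14 ∷ # 16 ∷ # 12 ∷ # 13 ∷ # 17 ∷ # 28 ∷ # 26 ∷ # 24 ∷ # 27 ∷ # 25 ∷ # 37 ∷ # 34 ∷ # 38 ∷ # 35 ∷ # 36 ∷
     # 47 ∷ # 48 ∷ # 44 ∷ # 46 ∷ # 45 ∷ [])
  ∷ (# 1 ∷ # 0 ∷ # 3 ∷ # 2 ∷ # 21 ∷ # 20 ∷ # 18 ∷ # 19 ∷ # 23 ∷ # 22 ∷ # 29 ∷ # 31 ∷ # 32 ∷ # 33 ∷ # 30 ∷ # 43 ∷ # 39 ∷ # 42 ∷ # 40 ∷ # 41 ∷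
     # 52 ∷ # 49 ∷ # 51 ∷ # 50 ∷ # 53 ∷ [])
  ∷ (# 4 ∷ # 5 ∷ # 6 ∷ # 7 ∷ # 12 ∷ # 16 ∷ # 15 ∷ # 14 ∷ # 17 ∷ # 13 ∷ # 27 ∷ # 24 ∷ # 28 ∷ # 25 ∷ # 26 ∷ # 42 ∷ # 41 ∷ # 39 ∷ # 43 ∷ # 40 ∷
     # 49 ∷ # 50 ∷ # 52 ∷ # 53 ∷ # 51 ∷ [])
  ∷ (# 6 ∷ # 7 ∷ # 4 ∷ # 5 ∷ # 20 ∷ # 18 ∷ # 19 ∷ # 23 ∷ # 22 ∷ # 21 ∷ # 33 ∷ # 30 ∷ # 29 ∷ # 32 ∷ # 31 ∷ # 38 ∷ # 36 ∷ # 34 ∷ # 37 ∷ # 35 ∷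
     # 44 ∷ # 46 ∷ # 48 ∷ # 45 ∷ # 47 ∷ [])
  ∷ (# 8 ∷ # 9 ∷ # 10 ∷ # 11 ∷ # 14 ∷ # 13 ∷ # 12 ∷ # 17 ∷ # 16 ∷ # 15 ∷ # 32 ∷ # 29 ∷ # 31 ∷ # 30 ∷ # 33 ∷ # 34 ∷ # 38 ∷ # 35 ∷ # 36 ∷ # 37 ∷
     # 53 ∷ # 51 ∷ # 49 ∷ # 52 ∷ # 50 ∷ [])
  ∷ (# 11 ∷ # 10 ∷ # 9 ∷ # 8 ∷ # 22 ∷ # 19 ∷ # 21 ∷ # 18 ∷ # 20 ∷ # 23 ∷ # 24 ∷ # 28 ∷ # 25 ∷ # 26 ∷ # 27 ∷ # 39 ∷ # 40 ∷ # 41 ∷ # 42 ∷ # 43 ∷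
     # 48 ∷ # 44 ∷ # 45 ∷ # 47 ∷ # 46 ∷ [])
  ∷ []

colouring25 : HasCompleteColouring (KK 6 25) 54
colouring25 = table⇒hasCompleteColouring table25 _

table26 : Table 6 26 56
table26 =
    (# 0 ∷ # 1 ∷ # 2 ∷ # 3 ∷ # 16 ∷ # 14 ∷ # 13 ∷ # 15 ∷ # 12 ∷ # 17 ∷ # 28 ∷ # 26 ∷ # 25 ∷ # 27 ∷ # 24 ∷ # 29 ∷ # 37 ∷ # 38 ∷ # 36 ∷ # 39 ∷
     # 40 ∷ # 48 ∷ # 50 ∷ # 46 ∷ # 47 ∷ # 49 ∷ [])
  ∷ (# 1 ∷ # 0 ∷ # 3 ∷ # 2 ∷ # 18 ∷ # 19 ∷ # 21 ∷ # 22 ∷ # 20 ∷ # 23 ∷ # 32 ∷ # 34 ∷ # 30 ∷ # 35 ∷ # 31 ∷ # 33 ∷ # 45 ∷ # 41 ∷ # 44 ∷ # 43 ∷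
     # 42 ∷ # 53 ∷ # 55 ∷ # 54 ∷ # 51 ∷ # 52 ∷ [])
  ∷ (# 4 ∷ # 5 ∷ # 6 ∷ # 7 ∷ # 14 ∷ # 13 ∷ # 17 ∷ # 12 ∷ # 16 ∷ # 15 ∷ # 26 ∷ # 25 ∷ # 29 ∷ # 24 ∷ # 28 ∷ # 27 ∷ # 44 ∷ # 45 ∷ # 42 ∷ # 41 ∷
     # 43 ∷ # 55 ∷ # 51 ∷ # 52 ∷ # 54 ∷ # 53 ∷ [])
  ∷ (# 6 ∷ # 7 ∷ # 4 ∷ # 5 ∷ # 20 ∷ # 18 ∷ # 19 ∷ # 23 ∷ # 21 ∷ # 22 ∷ # 30 ∷ # 31 ∷ # 33 ∷ # 34 ∷ # 32 ∷ # 35 ∷ # 38 ∷ # 36 ∷ # 40 ∷ # 37 ∷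
     # 39 ∷ # 49 ∷ # 48 ∷ # 47 ∷ # 46 ∷ # 50 ∷ [])
  ∷ (# 8 ∷ # 9 ∷ # 10 ∷ # 11 ∷ # 17 ∷ # 12 ∷ # 15 ∷ # 13 ∷ # 14 ∷ # 16 ∷ # 35 ∷ # 30 ∷ # 31 ∷ # 32 ∷ # 33 ∷ # 34 ∷ # 39 ∷ # 40 ∷ # 37 ∷ # 36 ∷
     # 38 ∷ # 54 ∷ # 52 ∷ # 55 ∷ # 53 ∷ # 51 ∷ [])
  ∷ (# 11 ∷ # 10 ∷ # 9 ∷ # 8 ∷ # 23 ∷ # 22 ∷ # 18 ∷ # 20 ∷ # 19 ∷ # 21 ∷ # 29 ∷ # 24 ∷ # 27 ∷ # 25 ∷ # 26 ∷ # 28 ∷ # 43 ∷ # 42 ∷ # 45 ∷ # 44 ∷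
     # 41 ∷ # 47 ∷ # 46 ∷ # 50 ∷ # 49 ∷ # 48 ∷ [])
  ∷ []

colouring26 : HasCompleteColouring (KK 6 26) 56
colouring26 = table⇒hasCompleteColouring table26 _

table27 : Table 6 27 58
table27 =
    (# 0 ∷ # 1 ∷ # 2 ∷ # 3 ∷ # 16 ∷ # 13 ∷ # 15 ∷ # 17 ∷ # 12 ∷ # 14 ∷ # 26 ∷ # 25 ∷ # 28 ∷ # 29 ∷ # 27 ∷ # 24 ∷ # 40 ∷ # 37 ∷ # 41 ∷ # 39 ∷
     # 38 ∷ # 36 ∷ # 48 ∷ # 50 ∷ # 52 ∷ # 51 ∷ # 49 ∷ [])
  ∷ (# 1 ∷ # 0 ∷ # 3 ∷ # 2 ∷ # 21 ∷ # 23 ∷ # 22 ∷ # 20 ∷ # 19 ∷ # 18 ∷ # 33 ∷ # 35 ∷ # 34 ∷ # 32 ∷ # 31 ∷ # 30 ∷ # 43 ∷ # 42 ∷ # 45 ∷ # 47 ∷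
     # 46 ∷ # 44 ∷ # 55 ∷ # 54 ∷ # 56 ∷ # 57 ∷ # 53 ∷ [])
  ∷ (# 4 ∷ # 5 ∷ # 6 ∷ # 7 ∷ # 13 ∷ # 17 ∷ # 16 ∷ # 15 ∷ # 14 ∷ # 12 ∷ # 28 ∷ # 29 ∷ # 27 ∷ # 24 ∷ # 26 ∷ # 25 ∷ # 47 ∷ # 46 ∷ # 44 ∷ # 43 ∷
     # 42 ∷ # 45 ∷ # 57 ∷ # 56 ∷ # 54 ∷ # 53 ∷ # 55 ∷ [])
  ∷ (# 6 ∷ # 7 ∷ # 4 ∷ # 5 ∷ # 19 ∷ # 18 ∷ # 20 ∷ # 23 ∷ # 22 ∷ # 21 ∷ # 31 ∷ # 30 ∷ # 32 ∷ # 35 ∷ # 34 ∷ # 33 ∷ # 38 ∷ # 40 ∷ # 39 ∷ # 41 ∷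
     # 36 ∷ # 37 ∷ # 52 ∷ # 48 ∷ # 49 ∷ # 50 ∷ # 51 ∷ [])
  ∷ (# 8 ∷ # 9 ∷ # 10 ∷ # 11 ∷ # 14 ∷ # 16 ∷ # 17 ∷ # 12 ∷ # 15 ∷ # 13 ∷ # 35 ∷ # 34 ∷ # 33 ∷ # 31 ∷ # 30 ∷ # 32 ∷ # 37 ∷ # 41 ∷ # 40 ∷ # 36 ∷
     # 39 ∷ # 38 ∷ # 54 ∷ # 53 ∷ # 55 ∷ # 56 ∷ # 57 ∷ [])
  ∷ (# 11 ∷ # 10 ∷ # 9 ∷ # 8 ∷ # 23 ∷ # 22 ∷ # 21 ∷ # 19 ∷ # 18 ∷ # 20 ∷ # 25 ∷ # 28 ∷ # 29 ∷ # 27 ∷ # 24 ∷ # 26 ∷ # 45 ∷ # 47 ∷ # 46 ∷ # 44 ∷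
     # 43 ∷ # 42 ∷ # 50 ∷ # 52 ∷ # 51 ∷ # 49 ∷ # 48 ∷ [])
  ∷ []

colouring27 : HasCompleteColouring (KK 6 27) 58
colouring27 = table⇒hasCompleteColouring table27 _

table28 : Table 6 28 60
table28 =
    (# 0 ∷ # 1 ∷ # 2 ∷ # 3 ∷ # 14 ∷ # 13 ∷ # 16 ∷ # 17 ∷ # 15 ∷ # 12 ∷ # 29 ∷ # 24 ∷ # 25 ∷ # 27 ∷ # 28 ∷ # 26 ∷ # 38 ∷ # 37 ∷ # 39 ∷ # 40 ∷
     # 36 ∷ # 41 ∷ # 49 ∷ # 48 ∷ # 52 ∷ # 53 ∷ # 51 ∷ # 50 ∷ [])
  ∷ (# 1 ∷ # 0 ∷ # 3 ∷ # 2 ∷ # 19 ∷ # 23 ∷ # 21 ∷ # 22 ∷ # 18 ∷ # 20 ∷ # 31 ∷ # 34 ∷ # 32 ∷ # 33 ∷ # 35 ∷ # 30 ∷ # 43 ∷ # 46 ∷ # 44 ∷ # 45 ∷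
     # 47 ∷ # 42 ∷ # 54 ∷ # 58 ∷ # 55 ∷ # 57 ∷ # 59 ∷ # 56 ∷ [])
  ∷ (# 4 ∷ # 5 ∷ # 6 ∷ # 7 ∷ # 17 ∷ # 12 ∷ # 13 ∷ # 15 ∷ # 16 ∷ # 14 ∷ # 26 ∷ # 25 ∷ # 28 ∷ # 29 ∷ # 27 ∷ # 24 ∷ # 42 ∷ # 47 ∷ # 43 ∷ # 44 ∷
     # 46 ∷ # 45 ∷ # 59 ∷ # 55 ∷ # 56 ∷ # 58 ∷ # 54 ∷ # 57 ∷ [])
  ∷ (# 6 ∷ # 7 ∷ # 4 ∷ # 5 ∷ # 18 ∷ # 22 ∷ # 19 ∷ # 20 ∷ # 23 ∷ # 21 ∷ # 35 ∷ # 31 ∷ # 33 ∷ # 34 ∷ # 30 ∷ # 32 ∷ # 41 ∷ # 36 ∷ # 37 ∷ # 39 ∷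
     # 40 ∷ # 38 ∷ # 53 ∷ # 50 ∷ # 49 ∷ # 51 ∷ # 52 ∷ # 48 ∷ [])
  ∷ (# 8 ∷ # 9 ∷ # 10 ∷ # 11 ∷ # 13 ∷ # 14 ∷ # 15 ∷ # 16 ∷ # 12 ∷ # 17 ∷ # 30 ∷ # 35 ∷ # 31 ∷ # 32 ∷ # 34 ∷ # 33 ∷ # 37 ∷ # 38 ∷ # 40 ∷ # 41 ∷
     # 39 ∷ # 36 ∷ # 55 ∷ # 59 ∷ # 57 ∷ # 56 ∷ # 58 ∷ # 54 ∷ [])
  ∷ (# 11 ∷ # 10 ∷ # 9 ∷ # 8 ∷ # 23 ∷ # 19 ∷ # 20 ∷ # 21 ∷ # 22 ∷ # 18 ∷ # 25 ∷ # 26 ∷ # 27 ∷ # 28 ∷ # 24 ∷ # 29 ∷ # 47 ∷ # 43 ∷ # 45 ∷ # 46 ∷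
     # 42 ∷ # 44 ∷ # 50 ∷ # 49 ∷ # 51 ∷ # 52 ∷ # 48 ∷ # 53 ∷ [])
  ∷ []

colouring28 : HasCompleteColouring (KK 6 28) 60
colouring28 = table⇒hasCompleteColouring table28 _

table29 : Table 6 29 62
table29 =
    (# 0 ∷ # 1 ∷ # 2 ∷ # 3 ∷ # 18 ∷ # 17 ∷ # 14 ∷ # 12 ∷ # 13 ∷ # 16 ∷ # 15 ∷ # 26 ∷ # 28 ∷ # 30 ∷ # 27 ∷ # 29 ∷ # 31 ∷ # 38 ∷ # 40 ∷ # 43 ∷
     # 41 ∷ # 39 ∷ # 42 ∷ # 52 ∷ # 51 ∷ # 50 ∷ # 54 ∷ # 53 ∷ # 55 ∷ [])
  ∷ (# 1 ∷ # 0 ∷ # 3 ∷ # 2 ∷ # 20 ∷ # 25 ∷ # 22 ∷ # 21 ∷ # 23 ∷ # 24 ∷ # 19 ∷ # 37 ∷ # 34 ∷ # 33 ∷ # 36 ∷ # 32 ∷ # 35 ∷ # 48 ∷ # 46 ∷ # 44 ∷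
     # 49 ∷ # 47 ∷ # 45 ∷ # 56 ∷ # 60 ∷ # 61 ∷ # 59 ∷ # 58 ∷ # 57 ∷ [])
  ∷ (# 4 ∷ # 5 ∷ # 6 ∷ # 7 ∷ # 15 ∷ # 18 ∷ # 16 ∷ # 13 ∷ # 14 ∷ # 17 ∷ # 12 ∷ # 31 ∷ # 29 ∷ # 26 ∷ # 30 ∷ # 27 ∷ # 28 ∷ # 49 ∷ # 48 ∷ # 45 ∷
     # 47 ∷ # 44 ∷ # 46 ∷ # 60 ∷ # 58 ∷ # 57 ∷ # 61 ∷ # 56 ∷ # 59 ∷ [])
  ∷ (# 6 ∷ # 7 ∷ # 4 ∷ # 5 ∷ # 21 ∷ # 23 ∷ # 24 ∷ # 19 ∷ # 25 ∷ # 22 ∷ # 20 ∷ # 32 ∷ # 36 ∷ # 37 ∷ # 35 ∷ # 34 ∷ # 33 ∷ # 43 ∷ # 39 ∷ # 38 ∷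
     # 42 ∷ # 41 ∷ # 40 ∷ # 50 ∷ # 52 ∷ # 55 ∷ # 53 ∷ # 51 ∷ # 54 ∷ [])
  ∷ (# 8 ∷ # 9 ∷ # 10 ∷ # 11 ∷ # 13 ∷ # 16 ∷ # 12 ∷ # 14 ∷ # 15 ∷ # 18 ∷ # 17 ∷ # 36 ∷ # 33 ∷ # 32 ∷ # 37 ∷ # 35 ∷ # 34 ∷ # 40 ∷ # 41 ∷ # 42 ∷
     # 39 ∷ # 38 ∷ # 43 ∷ # 61 ∷ # 57 ∷ # 56 ∷ # 60 ∷ # 59 ∷ # 58 ∷ [])
  ∷ (# 11 ∷ # 10 ∷ # 9 ∷ # 8 ∷ # 22 ∷ # 21 ∷ # 20 ∷ # 25 ∷ # 24 ∷ # 19 ∷ # 23 ∷ # 28 ∷ # 27 ∷ # 31 ∷ # 29 ∷ # 26 ∷ # 30 ∷ # 44 ∷ # 45 ∷ # 49 ∷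
     # 48 ∷ # 46 ∷ # 47 ∷ # 55 ∷ # 53 ∷ # 54 ∷ # 51 ∷ # 50 ∷ # 52 ∷ [])
  ∷ []

colouring29 : HasCompleteColouring (KK 6 29) 62
colouring29 = table⇒hasCompleteColouring table29 _

table30 : Table 6 30 64
table30 =
    (# 0 ∷ # 1 ∷ # 2 ∷ # 3 ∷ # 15 ∷ # 14 ∷ # 12 ∷ # 17 ∷ # 13 ∷ # 18 ∷ # 16 ∷ # 30 ∷ # 26 ∷ # 32 ∷ # 31 ∷ # 29 ∷ # 27 ∷ # 28 ∷ # 41 ∷ # 44 ∷
     # 42 ∷ # 40 ∷ # 45 ∷ # 43 ∷ # 54 ∷ # 55 ∷ # 57 ∷ # 52 ∷ # 56 ∷ # 53 ∷ [])
  ∷ (# 1 ∷ # 0 ∷ # 3 ∷ # 2 ∷ # 19 ∷ # 23 ∷ # 20 ∷ # 21 ∷ # 25 ∷ # 24 ∷ # 22 ∷ # 39 ∷ # 38 ∷ # 33 ∷ # 37 ∷ # 35 ∷ # 36 ∷ # 34 ∷ # 47 ∷ # 48 ∷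
     # 49 ∷ # 50 ∷ # 46 ∷ # 51 ∷ # 58 ∷ # 60 ∷ # 61 ∷ # 63 ∷ # 62 ∷ # 59 ∷ [])
  ∷ (# 4 ∷ # 5 ∷ # 6 ∷ # 7 ∷ # 17 ∷ # 13 ∷ # 18 ∷ # 12 ∷ # 15 ∷ # 16 ∷ # 14 ∷ # 29 ∷ # 27 ∷ # 31 ∷ # 26 ∷ # 28 ∷ # 32 ∷ # 30 ∷ # 49 ∷ # 47 ∷
     # 48 ∷ # 51 ∷ # 50 ∷ # 46 ∷ # 61 ∷ # 59 ∷ # 62 ∷ # 60 ∷ # 58 ∷ # 63 ∷ [])
  ∷ (# 6 ∷ # 7 ∷ # 4 ∷ # 5 ∷ # 24 ∷ # 19 ∷ # 25 ∷ # 22 ∷ # 21 ∷ # 23 ∷ # 20 ∷ # 38 ∷ # 33 ∷ # 34 ∷ # 35 ∷ # 39 ∷ # 37 ∷ # 36 ∷ # 42 ∷ # 40 ∷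
     # 41 ∷ # 43 ∷ # 44 ∷ # 45 ∷ # 53 ∷ # 52 ∷ # 54 ∷ # 56 ∷ # 57 ∷ # 55 ∷ [])
  ∷ (# 8 ∷ # 9 ∷ # 10 ∷ # 11 ∷ # 16 ∷ # 12 ∷ # 17 ∷ # 15 ∷ # 14 ∷ # 13 ∷ # 18 ∷ # 33 ∷ # 37 ∷ # 39 ∷ # 36 ∷ # 34 ∷ # 38 ∷ # 35 ∷ # 40 ∷ # 43 ∷
     # 45 ∷ # 44 ∷ # 42 ∷ # 41 ∷ # 59 ∷ # 61 ∷ # 60 ∷ # 62 ∷ # 63 ∷ # 58 ∷ [])
  ∷ (# 11 ∷ # 10 ∷ # 9 ∷ # 8 ∷ # 25 ∷ # 24 ∷ # 19 ∷ # 23 ∷ # 20 ∷ # 22 ∷ # 21 ∷ # 31 ∷ # 28 ∷ # 26 ∷ # 29 ∷ # 27 ∷ # 30 ∷ # 32 ∷ # 46 ∷ # 49 ∷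
     # 50 ∷ # 48 ∷ # 51 ∷ # 47 ∷ # 52 ∷ # 56 ∷ # 53 ∷ # 55 ∷ # 54 ∷ # 57 ∷ [])
  ∷ []

colouring30 : HasCompleteColouring (KK 6 30) 64
colouring30 = table⇒hasCompleteColouring table30 _

table31 : Table 6 31 66
table31 =
    (# 0 ∷ # 1 ∷ # 2 ∷ # 3 ∷ # 16 ∷ # 14 ∷ # 13 ∷ # 12 ∷ # 18 ∷ # 15 ∷ # 17 ∷ # 30 ∷ # 28 ∷ # 27 ∷ # 26 ∷ # 32 ∷ # 29 ∷ # 31 ∷ # 46 ∷ # 40 ∷
     # 41 ∷ # 42 ∷ # 43 ∷ # 44 ∷ # 45 ∷ # 59 ∷ # 55 ∷ # 58 ∷ # 54 ∷ # 56 ∷ # 57 ∷ [])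
  ∷ (# 1 ∷ # 0 ∷ # 3 ∷ # 2 ∷ # 22 ∷ # 25 ∷ # 21 ∷ # 24 ∷ # 20 ∷ # 19 ∷ # 23 ∷ # 38 ∷ # 37 ∷ # 33 ∷ # 36 ∷ # 35 ∷ # 34 ∷ # 39 ∷ # 51 ∷ # 49 ∷
     # 53 ∷ # 48 ∷ # 52 ∷ # 50 ∷ # 47 ∷ # 64 ∷ # 65 ∷ # 63 ∷ # 61 ∷ # 62 ∷ # 60 ∷ [])
  ∷ (# 4 ∷ # 5 ∷ # 6 ∷ # 7 ∷ # 13 ∷ # 15 ∷ # 12 ∷ # 14 ∷ # 17 ∷ # 16 ∷ # 18 ∷ # 27 ∷ # 26 ∷ # 30 ∷ # 28 ∷ # 29 ∷ # 31 ∷ # 32 ∷ # 50 ∷ # 53 ∷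
     # 49 ∷ # 52 ∷ # 48 ∷ # 47 ∷ # 51 ∷ # 65 ∷ # 64 ∷ # 60 ∷ # 62 ∷ # 63 ∷ # 61 ∷ [])
  ∷ (# 6 ∷ # 7 ∷ # 4 ∷ # 5 ∷ # 23 ∷ # 21 ∷ # 25 ∷ # 22 ∷ # 24 ∷ # 20 ∷ # 19 ∷ # 36 ∷ # 35 ∷ # 39 ∷ # 34 ∷ # 38 ∷ # 33 ∷ # 37 ∷ # 41 ∷ # 42 ∷
     # 44 ∷ # 40 ∷ # 45 ∷ # 43 ∷ # 46 ∷ # 58 ∷ # 56 ∷ # 59 ∷ # 55 ∷ # 57 ∷ # 54 ∷ [])
  ∷ (# 8 ∷ # 9 ∷ # 10 ∷ # 11 ∷ # 18 ∷ # 12 ∷ # 16 ∷ # 13 ∷ # 15 ∷ # 17 ∷ # 14 ∷ # 37 ∷ # 39 ∷ # 35 ∷ # 38 ∷ # 34 ∷ # 36 ∷ # 33 ∷ # 44 ∷ # 43 ∷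
     # 40 ∷ # 41 ∷ # 46 ∷ # 45 ∷ # 42 ∷ # 63 ∷ # 60 ∷ # 65 ∷ # 64 ∷ # 61 ∷ # 62 ∷ [])
  ∷ (# 11 ∷ # 10 ∷ # 9 ∷ # 8 ∷ # 24 ∷ # 23 ∷ # 19 ∷ # 20 ∷ # 21 ∷ # 22 ∷ # 25 ∷ # 32 ∷ # 29 ∷ # 26 ∷ # 27 ∷ # 31 ∷ # 30 ∷ # 28 ∷ # 52 ∷ # 51 ∷
     # 47 ∷ # 50 ∷ # 49 ∷ # 48 ∷ # 53 ∷ # 54 ∷ # 57 ∷ # 56 ∷ # 59 ∷ # 55 ∷ # 58 ∷ [])
  ∷ []

colouring31 : HasCompleteColouring (KK 6 31) 66
colouring31 = table⇒hasCompleteColouring table31 _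

table32 : Table 6 32 68
table32 =
    (# 0 ∷ # 1 ∷ # 2 ∷ # 3 ∷ # 14 ∷ # 15 ∷ # 16 ∷ # 12 ∷ # 17 ∷ # 13 ∷ # 18 ∷ # 26 ∷ # 30 ∷ # 31 ∷ # 28 ∷ # 32 ∷ # 29 ∷ # 27 ∷ # 42 ∷ # 43 ∷
     # 45 ∷ # 40 ∷ # 46 ∷ # 41 ∷ # 44 ∷ # 56 ∷ # 57 ∷ # 58 ∷ # 54 ∷ # 59 ∷ # 55 ∷ # 60 ∷ [])
  ∷ (# 1 ∷ # 0 ∷ # 3 ∷ # 2 ∷ # 25 ∷ # 20 ∷ # 24 ∷ # 22 ∷ # 19 ∷ # 23 ∷ # 21 ∷ # 39 ∷ # 37 ∷ # 34 ∷ # 35 ∷ # 33 ∷ # 38 ∷ # 36 ∷ # 47 ∷ # 50 ∷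
     # 48 ∷ # 49 ∷ # 51 ∷ # 52 ∷ # 53 ∷ # 67 ∷ # 64 ∷ # 62 ∷ # 66 ∷ # 61 ∷ # 65 ∷ # 63 ∷ [])
  ∷ (# 4 ∷ # 5 ∷ # 6 ∷ # 7 ∷ # 12 ∷ # 14 ∷ # 18 ∷ # 17 ∷ # 13 ∷ # 15 ∷ # 16 ∷ # 29 ∷ # 28 ∷ # 30 ∷ # 26 ∷ # 31 ∷ # 27 ∷ # 32 ∷ # 49 ∷ # 51 ∷
     # 47 ∷ # 52 ∷ # 53 ∷ # 48 ∷ # 50 ∷ # 61 ∷ # 65 ∷ # 66 ∷ # 63 ∷ # 67 ∷ # 62 ∷ # 64 ∷ [])
  ∷ (# 6 ∷ # 7 ∷ # 4 ∷ # 5 ∷ # 19 ∷ # 23 ∷ # 20 ∷ # 21 ∷ # 25 ∷ # 24 ∷ # 22 ∷ # 33 ∷ # 34 ∷ # 38 ∷ # 36 ∷ # 39 ∷ # 37 ∷ # 35 ∷ # 43 ∷ # 42 ∷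
     # 44 ∷ # 45 ∷ # 41 ∷ # 40 ∷ # 46 ∷ # 57 ∷ # 56 ∷ # 60 ∷ # 59 ∷ # 55 ∷ # 54 ∷ # 58 ∷ [])
  ∷ (# 8 ∷ # 9 ∷ # 10 ∷ # 11 ∷ # 15 ∷ # 16 ∷ # 17 ∷ # 14 ∷ # 18 ∷ # 12 ∷ # 13 ∷ # 35 ∷ # 36 ∷ # 33 ∷ # 38 ∷ # 37 ∷ # 34 ∷ # 39 ∷ # 40 ∷ # 44 ∷
     # 46 ∷ # 42 ∷ # 45 ∷ # 43 ∷ # 41 ∷ # 63 ∷ # 62 ∷ # 61 ∷ # 64 ∷ # 65 ∷ # 66 ∷ # 67 ∷ [])
  ∷ (# 11 ∷ # 10 ∷ # 9 ∷ # 8 ∷ # 21 ∷ # 22 ∷ # 19 ∷ # 24 ∷ # 23 ∷ # 20 ∷ # 25 ∷ # 28 ∷ # 29 ∷ # 32 ∷ # 31 ∷ # 27 ∷ # 26 ∷ # 30 ∷ # 53 ∷ # 48 ∷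
     # 52 ∷ # 50 ∷ # 47 ∷ # 51 ∷ # 49 ∷ # 54 ∷ # 58 ∷ # 59 ∷ # 56 ∷ # 60 ∷ # 57 ∷ # 55 ∷ [])
  ∷ []

colouring32 : HasCompleteColouring (KK 6 32) 68
colouring32 = table⇒hasCompleteColouring table32 _

table33 : Table 6 33 70
table33 =
    (# 0 ∷ # 1 ∷ # 2 ∷ # 3 ∷ # 16 ∷ # 14 ∷ # 15 ∷ # 19 ∷ # 18 ∷ # 17 ∷ # 13 ∷ # 12 ∷ # 33 ∷ # 28 ∷ # 31 ∷ # 30 ∷ # 32 ∷ # 29 ∷ # 34 ∷ # 47 ∷
     # 42 ∷ # 48 ∷ # 44 ∷ # 45 ∷ # 43 ∷ # 46 ∷ # 58 ∷ # 56 ∷ # 62 ∷ # 57 ∷ # 59 ∷ # 60 ∷ # 61 ∷ [])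
  ∷ (# 1 ∷ # 0 ∷ # 3 ∷ # 2 ∷ # 25 ∷ # 20 ∷ # 22 ∷ # 27 ∷ # 26 ∷ # 23 ∷ # 21 ∷ # 24 ∷ # 40 ∷ # 35 ∷ # 37 ∷ # 36 ∷ # 41 ∷ # 39 ∷ # 38 ∷ # 55 ∷
     # 49 ∷ # 52 ∷ # 51 ∷ # 50 ∷ # 54 ∷ # 53 ∷ # 64 ∷ # 63 ∷ # 65 ∷ # 66 ∷ # 69 ∷ # 68 ∷ # 67 ∷ [])
  ∷ (# 4 ∷ # 5 ∷ # 6 ∷ # 7 ∷ # 12 ∷ # 19 ∷ # 18 ∷ # 13 ∷ # 16 ∷ # 15 ∷ # 14 ∷ # 17 ∷ # 28 ∷ # 30 ∷ # 34 ∷ # 29 ∷ # 31 ∷ # 32 ∷ # 33 ∷ # 50 ∷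
     # 53 ∷ # 54 ∷ # 52 ∷ # 55 ∷ # 51 ∷ # 49 ∷ # 68 ∷ # 69 ∷ # 66 ∷ # 65 ∷ # 64 ∷ # 67 ∷ # 63 ∷ [])
  ∷ (# 6 ∷ # 7 ∷ # 4 ∷ # 5 ∷ # 23 ∷ # 24 ∷ # 25 ∷ # 21 ∷ # 27 ∷ # 20 ∷ # 22 ∷ # 26 ∷ # 36 ∷ # 41 ∷ # 38 ∷ # 37 ∷ # 35 ∷ # 40 ∷ # 39 ∷ # 42 ∷
     # 44 ∷ # 45 ∷ # 43 ∷ # 48 ∷ # 46 ∷ # 47 ∷ # 61 ∷ # 57 ∷ # 56 ∷ # 58 ∷ # 60 ∷ # 59 ∷ # 62 ∷ [])
  ∷ (# 8 ∷ # 9 ∷ # 10 ∷ # 11 ∷ # 19 ∷ # 13 ∷ # 17 ∷ # 15 ∷ # 14 ∷ # 12 ∷ # 18 ∷ # 16 ∷ # 41 ∷ # 39 ∷ # 40 ∷ # 38 ∷ # 36 ∷ # 37 ∷ # 35 ∷ # 44 ∷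
     # 43 ∷ # 42 ∷ # 47 ∷ # 46 ∷ # 45 ∷ # 48 ∷ # 69 ∷ # 67 ∷ # 68 ∷ # 64 ∷ # 63 ∷ # 65 ∷ # 66 ∷ [])
  ∷ (# 11 ∷ # 10 ∷ # 9 ∷ # 8 ∷ # 22 ∷ # 25 ∷ # 24 ∷ # 26 ∷ # 20 ∷ # 27 ∷ # 23 ∷ # 21 ∷ # 30 ∷ # 29 ∷ # 28 ∷ # 33 ∷ # 34 ∷ # 31 ∷ # 32 ∷ # 54 ∷
     # 55 ∷ # 51 ∷ # 50 ∷ # 49 ∷ # 53 ∷ # 52 ∷ # 56 ∷ # 58 ∷ # 59 ∷ # 61 ∷ # 62 ∷ # 57 ∷ # 60 ∷ [])
  ∷ []

colouring33 : HasCompleteColouring (KK 6 33) 70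
colouring33 = table⇒hasCompleteColouring table33 _

table34 : Table 6 34 72
table34 =
    (# 0 ∷ # 1 ∷ # 2 ∷ # 3 ∷ # 13 ∷ # 17 ∷ # 15 ∷ # 19 ∷ # 18 ∷ # 16 ∷ # 12 ∷ # 14 ∷ # 35 ∷ # 30 ∷ # 31 ∷ # 28 ∷ # 34 ∷ # 33 ∷ # 32 ∷ # 29 ∷
     # 49 ∷ # 48 ∷ # 50 ∷ # 44 ∷ # 47 ∷ # 45 ∷ # 46 ∷ # 60 ∷ # 63 ∷ # 62 ∷ # 61 ∷ # 64 ∷ # 59 ∷ # 58 ∷ [])
  ∷ (# 1 ∷ # 0 ∷ # 3 ∷ # 2 ∷ # 24 ∷ # 20 ∷ # 22 ∷ # 27 ∷ # 25 ∷ # 26 ∷ # 23 ∷ # 21 ∷ # 40 ∷ # 41 ∷ # 36 ∷ # 43 ∷ # 42 ∷ # 38 ∷ # 39 ∷ # 37 ∷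
     # 52 ∷ # 53 ∷ # 56 ∷ # 57 ∷ # 54 ∷ # 51 ∷ # 55 ∷ # 66 ∷ # 65 ∷ # 70 ∷ # 69 ∷ # 68 ∷ # 67 ∷ # 71 ∷ [])
  ∷ (# 4 ∷ # 5 ∷ # 6 ∷ # 7 ∷ # 15 ∷ # 12 ∷ # 19 ∷ # 14 ∷ # 16 ∷ # 17 ∷ # 18 ∷ # 13 ∷ # 31 ∷ # 33 ∷ # 34 ∷ # 35 ∷ # 32 ∷ # 29 ∷ # 28 ∷ # 30 ∷
     # 51 ∷ # 54 ∷ # 55 ∷ # 52 ∷ # 57 ∷ # 53 ∷ # 56 ∷ # 65 ∷ # 67 ∷ # 66 ∷ # 71 ∷ # 70 ∷ # 68 ∷ # 69 ∷ [])
  ∷ (# 6 ∷ # 7 ∷ # 4 ∷ # 5 ∷ # 25 ∷ # 23 ∷ # 20 ∷ # 26 ∷ # 27 ∷ # 22 ∷ # 21 ∷ # 24 ∷ # 39 ∷ # 36 ∷ # 37 ∷ # 38 ∷ # 41 ∷ # 42 ∷ # 40 ∷ # 43 ∷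
     # 46 ∷ # 49 ∷ # 48 ∷ # 47 ∷ # 45 ∷ # 50 ∷ # 44 ∷ # 61 ∷ # 62 ∷ # 64 ∷ # 58 ∷ # 59 ∷ # 60 ∷ # 63 ∷ [])
  ∷ (# 8 ∷ # 9 ∷ # 10 ∷ # 11 ∷ # 19 ∷ # 14 ∷ # 18 ∷ # 12 ∷ # 15 ∷ # 13 ∷ # 16 ∷ # 17 ∷ # 41 ∷ # 39 ∷ # 38 ∷ # 42 ∷ # 43 ∷ # 36 ∷ # 37 ∷ # 40 ∷
     # 47 ∷ # 44 ∷ # 45 ∷ # 48 ∷ # 50 ∷ # 46 ∷ # 49 ∷ # 67 ∷ # 68 ∷ # 69 ∷ # 66 ∷ # 71 ∷ # 65 ∷ # 70 ∷ [])
  ∷ (# 11 ∷ # 10 ∷ # 9 ∷ # 8 ∷ # 23 ∷ # 25 ∷ # 21 ∷ # 22 ∷ # 26 ∷ # 20 ∷ # 24 ∷ # 27 ∷ # 29 ∷ # 28 ∷ # 35 ∷ # 30 ∷ # 31 ∷ # 32 ∷ # 34 ∷ # 33 ∷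
     # 53 ∷ # 51 ∷ # 52 ∷ # 55 ∷ # 56 ∷ # 54 ∷ # 57 ∷ # 63 ∷ # 58 ∷ # 59 ∷ # 62 ∷ # 61 ∷ # 64 ∷ # 60 ∷ [])
  ∷ []

colouring34 : HasCompleteColouring (KK 6 34) 72
colouring34 = table⇒hasCompleteColouring table34 _

table35 : Table 6 35 74
table35 =
    (# 0 ∷ # 1 ∷ # 2 ∷ # 3 ∷ # 16 ∷ # 19 ∷ # 17 ∷ # 15 ∷ # 13 ∷ # 12 ∷ # 14 ∷ # 18 ∷ # 28 ∷ # 30 ∷ # 33 ∷ # 34 ∷ # 29 ∷ # 31 ∷ # 35 ∷ # 32 ∷
     # 44 ∷ # 51 ∷ # 50 ∷ # 47 ∷ # 49 ∷ # 45 ∷ # 46 ∷ # 48 ∷ # 66 ∷ # 65 ∷ # 60 ∷ # 64 ∷ # 63 ∷ # 62 ∷ # 61 ∷ [])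
  ∷ (# 1 ∷ # 0 ∷ # 3 ∷ # 2 ∷ # 22 ∷ # 20 ∷ # 27 ∷ # 25 ∷ # 24 ∷ # 21 ∷ # 26 ∷ # 23 ∷ # 38 ∷ # 36 ∷ # 43 ∷ # 37 ∷ # 40 ∷ # 42 ∷ # 39 ∷ # 41 ∷
     # 59 ∷ # 54 ∷ # 56 ∷ # 53 ∷ # 52 ∷ # 58 ∷ # 55 ∷ # 57 ∷ # 69 ∷ # 72 ∷ # 71 ∷ # 73 ∷ # 67 ∷ # 70 ∷ # 68 ∷ [])
  ∷ (# 4 ∷ # 5 ∷ # 6 ∷ # 7 ∷ # 19 ∷ # 13 ∷ # 14 ∷ # 18 ∷ # 17 ∷ # 15 ∷ # 16 ∷ # 12 ∷ # 35 ∷ # 29 ∷ # 30 ∷ # 31 ∷ # 33 ∷ # 28 ∷ # 32 ∷ # 34 ∷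
     # 54 ∷ # 52 ∷ # 58 ∷ # 57 ∷ # 56 ∷ # 59 ∷ # 53 ∷ # 55 ∷ # 70 ∷ # 68 ∷ # 73 ∷ # 69 ∷ # 72 ∷ # 67 ∷ # 71 ∷ [])
  ∷ (# 6 ∷ # 7 ∷ # 4 ∷ # 5 ∷ # 27 ∷ # 22 ∷ # 24 ∷ # 21 ∷ # 20 ∷ # 26 ∷ # 23 ∷ # 25 ∷ # 43 ∷ # 41 ∷ # 40 ∷ # 38 ∷ # 36 ∷ # 37 ∷ # 42 ∷ # 39 ∷
     # 51 ∷ # 45 ∷ # 46 ∷ # 49 ∷ # 47 ∷ # 44 ∷ # 48 ∷ # 50 ∷ # 61 ∷ # 63 ∷ # 65 ∷ # 60 ∷ # 62 ∷ # 66 ∷ # 64 ∷ [])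
  ∷ (# 8 ∷ # 9 ∷ # 10 ∷ # 11 ∷ # 12 ∷ # 14 ∷ # 18 ∷ # 17 ∷ # 15 ∷ # 13 ∷ # 19 ∷ # 16 ∷ # 40 ∷ # 38 ∷ # 42 ∷ # 41 ∷ # 39 ∷ # 43 ∷ # 37 ∷ # 36 ∷
     # 48 ∷ # 46 ∷ # 49 ∷ # 50 ∷ # 45 ∷ # 47 ∷ # 51 ∷ # 44 ∷ # 73 ∷ # 69 ∷ # 72 ∷ # 70 ∷ # 71 ∷ # 68 ∷ # 67 ∷ [])
  ∷ (# 11 ∷ # 10 ∷ # 9 ∷ # 8 ∷ # 24 ∷ # 25 ∷ # 26 ∷ # 22 ∷ # 23 ∷ # 27 ∷ # 21 ∷ # 20 ∷ # 32 ∷ # 35 ∷ # 34 ∷ # 33 ∷ # 31 ∷ # 29 ∷ # 30 ∷ # 28 ∷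
     # 56 ∷ # 57 ∷ # 59 ∷ # 54 ∷ # 55 ∷ # 53 ∷ # 58 ∷ # 52 ∷ # 63 ∷ # 64 ∷ # 61 ∷ # 62 ∷ # 66 ∷ # 65 ∷ # 60 ∷ [])
  ∷ []

colouring35 : HasCompleteColouring (KK 6 35) 74
colouring35 = table⇒hasCompleteColouring table35 _

table36 : Table 6 36 76
table36 =
    (# 0 ∷ # 1 ∷ # 2 ∷ # 3 ∷ # 19 ∷ # 17 ∷ # 15 ∷ # 14 ∷ # 18 ∷ # 12 ∷ # 13 ∷ # 16 ∷ # 33 ∷ # 35 ∷ # 31 ∷ # 30 ∷ # 34 ∷ # 28 ∷ # 29 ∷ # 32 ∷
     # 45 ∷ # 51 ∷ # 48 ∷ # 49 ∷ # 47 ∷ # 50 ∷ # 46 ∷ # 44 ∷ # 67 ∷ # 63 ∷ # 64 ∷ # 65 ∷ # 66 ∷ # 60 ∷ # 62 ∷ # 61 ∷ [])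
  ∷ (# 1 ∷ # 0 ∷ # 3 ∷ # 2 ∷ # 20 ∷ # 27 ∷ # 22 ∷ # 26 ∷ # 23 ∷ # 25 ∷ # 21 ∷ # 24 ∷ # 38 ∷ # 42 ∷ # 37 ∷ # 40 ∷ # 36 ∷ # 39 ∷ # 43 ∷ # 41 ∷
     # 55 ∷ # 57 ∷ # 53 ∷ # 58 ∷ # 52 ∷ # 54 ∷ # 59 ∷ # 56 ∷ # 68 ∷ # 75 ∷ # 70 ∷ # 74 ∷ # 71 ∷ # 73 ∷ # 69 ∷ # 72 ∷ [])
  ∷ (# 4 ∷ # 5 ∷ # 6 ∷ # 7 ∷ # 17 ∷ # 15 ∷ # 19 ∷ # 18 ∷ # 16 ∷ # 14 ∷ # 12 ∷ # 13 ∷ # 35 ∷ # 33 ∷ # 32 ∷ # 34 ∷ # 31 ∷ # 30 ∷ # 28 ∷ # 29 ∷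
     # 54 ∷ # 58 ∷ # 56 ∷ # 53 ∷ # 59 ∷ # 55 ∷ # 52 ∷ # 57 ∷ # 71 ∷ # 73 ∷ # 72 ∷ # 69 ∷ # 68 ∷ # 70 ∷ # 75 ∷ # 74 ∷ [])
  ∷ (# 6 ∷ # 7 ∷ # 4 ∷ # 5 ∷ # 22 ∷ # 26 ∷ # 21 ∷ # 24 ∷ # 27 ∷ # 23 ∷ # 20 ∷ # 25 ∷ # 39 ∷ # 41 ∷ # 40 ∷ # 37 ∷ # 43 ∷ # 38 ∷ # 36 ∷ # 42 ∷
     # 51 ∷ # 49 ∷ # 47 ∷ # 46 ∷ # 50 ∷ # 44 ∷ # 45 ∷ # 48 ∷ # 65 ∷ # 67 ∷ # 63 ∷ # 66 ∷ # 64 ∷ # 62 ∷ # 61 ∷ # 60 ∷ [])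
  ∷ (# 8 ∷ # 9 ∷ # 10 ∷ # 11 ∷ # 13 ∷ # 19 ∷ # 16 ∷ # 17 ∷ # 15 ∷ # 18 ∷ # 14 ∷ # 12 ∷ # 36 ∷ # 43 ∷ # 38 ∷ # 42 ∷ # 39 ∷ # 41 ∷ # 37 ∷ # 40 ∷
     # 49 ∷ # 47 ∷ # 51 ∷ # 50 ∷ # 48 ∷ # 46 ∷ # 44 ∷ # 45 ∷ # 70 ∷ # 74 ∷ # 69 ∷ # 72 ∷ # 75 ∷ # 71 ∷ # 68 ∷ # 73 ∷ [])
  ∷ (# 11 ∷ # 10 ∷ # 9 ∷ # 8 ∷ # 23 ∷ # 25 ∷ # 24 ∷ # 21 ∷ # 20 ∷ # 22 ∷ # 27 ∷ # 26 ∷ # 29 ∷ # 31 ∷ # 35 ∷ # 33 ∷ # 32 ∷ # 34 ∷ # 30 ∷ # 28 ∷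
     # 52 ∷ # 59 ∷ # 54 ∷ # 56 ∷ # 55 ∷ # 57 ∷ # 53 ∷ # 58 ∷ # 61 ∷ # 65 ∷ # 67 ∷ # 62 ∷ # 63 ∷ # 66 ∷ # 60 ∷ # 64 ∷ [])
  ∷ []

colouring36 : HasCompleteColouring (KK 6 36) 76
colouring36 = table⇒hasCompleteColouring table36 _

table37 : Table 6 37 78
table37 =
    (# 0 ∷ # 1 ∷ # 2 ∷ # 3 ∷ # 12 ∷ # 16 ∷ # 19 ∷ # 15 ∷ # 17 ∷ # 18 ∷ # 13 ∷ # 14 ∷ # 20 ∷ # 34 ∷ # 30 ∷ # 31 ∷ # 32 ∷ # 35 ∷ # 37 ∷ # 36 ∷
     # 33 ∷ # 53 ∷ # 46 ∷ # 47 ∷ # 48 ∷ # 50 ∷ # 52 ∷ # 51 ∷ # 49 ∷ # 69 ∷ # 66 ∷ # 63 ∷ # 64 ∷ # 65 ∷ # 62 ∷ # 67 ∷ # 68 ∷ [])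
  ∷ (# 1 ∷ # 0 ∷ # 3 ∷ # 2 ∷ # 26 ∷ # 29 ∷ # 28 ∷ # 22 ∷ # 24 ∷ # 27 ∷ # 25 ∷ # 23 ∷ # 21 ∷ # 42 ∷ # 38 ∷ # 44 ∷ # 41 ∷ # 43 ∷ # 39 ∷ # 45 ∷
     # 40 ∷ # 60 ∷ # 58 ∷ # 59 ∷ # 57 ∷ # 61 ∷ # 55 ∷ # 54 ∷ # 56 ∷ # 76 ∷ # 70 ∷ # 75 ∷ # 73 ∷ # 77 ∷ # 71 ∷ # 72 ∷ # 74 ∷ [])
  ∷ (# 4 ∷ # 5 ∷ # 6 ∷ # 7 ∷ # 17 ∷ # 20 ∷ # 12 ∷ # 19 ∷ # 13 ∷ # 16 ∷ # 14 ∷ # 15 ∷ # 18 ∷ # 37 ∷ # 31 ∷ # 33 ∷ # 30 ∷ # 34 ∷ # 36 ∷ # 35 ∷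
     # 32 ∷ # 57 ∷ # 56 ∷ # 54 ∷ # 55 ∷ # 59 ∷ # 60 ∷ # 61 ∷ # 58 ∷ # 73 ∷ # 74 ∷ # 76 ∷ # 77 ∷ # 71 ∷ # 75 ∷ # 70 ∷ # 72 ∷ [])
  ∷ (# 6 ∷ # 7 ∷ # 4 ∷ # 5 ∷ # 29 ∷ # 28 ∷ # 24 ∷ # 25 ∷ # 21 ∷ # 23 ∷ # 27 ∷ # 26 ∷ # 22 ∷ # 41 ∷ # 40 ∷ # 43 ∷ # 45 ∷ # 39 ∷ # 44 ∷ # 38 ∷
     # 42 ∷ # 51 ∷ # 50 ∷ # 48 ∷ # 47 ∷ # 49 ∷ # 46 ∷ # 53 ∷ # 52 ∷ # 67 ∷ # 62 ∷ # 65 ∷ # 63 ∷ # 66 ∷ # 68 ∷ # 69 ∷ # 64 ∷ [])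
  ∷ (# 8 ∷ # 9 ∷ # 10 ∷ # 11 ∷ # 13 ∷ # 18 ∷ # 15 ∷ # 12 ∷ # 16 ∷ # 20 ∷ # 17 ∷ # 19 ∷ # 14 ∷ # 44 ∷ # 42 ∷ # 38 ∷ # 39 ∷ # 45 ∷ # 43 ∷ # 40 ∷
     # 41 ∷ # 50 ∷ # 47 ∷ # 49 ∷ # 46 ∷ # 51 ∷ # 53 ∷ # 52 ∷ # 48 ∷ # 74 ∷ # 72 ∷ # 70 ∷ # 71 ∷ # 75 ∷ # 76 ∷ # 77 ∷ # 73 ∷ [])
  ∷ (# 11 ∷ # 10 ∷ # 9 ∷ # 8 ∷ # 23 ∷ # 25 ∷ # 21 ∷ # 27 ∷ # 22 ∷ # 26 ∷ # 28 ∷ # 29 ∷ # 24 ∷ # 35 ∷ # 34 ∷ # 32 ∷ # 31 ∷ # 33 ∷ # 30 ∷ # 37 ∷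
     # 36 ∷ # 58 ∷ # 54 ∷ # 60 ∷ # 61 ∷ # 55 ∷ # 59 ∷ # 56 ∷ # 57 ∷ # 66 ∷ # 63 ∷ # 64 ∷ # 62 ∷ # 67 ∷ # 69 ∷ # 68 ∷ # 65 ∷ [])
  ∷ []

colouring37 : HasCompleteColouring (KK 6 37) 78
colouring37 = table⇒hasCompleteColouring table37 _

table38 : Table 6 38 80
table38 =
    (# 0 ∷ # 1 ∷ # 2 ∷ # 3 ∷ # 20 ∷ # 14 ∷ # 19 ∷ # 13 ∷ # 15 ∷ # 18 ∷ # 12 ∷ # 16 ∷ # 17 ∷ # 38 ∷ # 32 ∷ # 37 ∷ # 31 ∷ # 36 ∷ # 33 ∷ # 30 ∷
     # 34 ∷ # 35 ∷ # 48 ∷ # 55 ∷ # 49 ∷ # 51 ∷ # 52 ∷ # 53 ∷ # 54 ∷ # 50 ∷ # 71 ∷ # 64 ∷ # 67 ∷ # 68 ∷ # 70 ∷ # 65 ∷ # 69 ∷ # 66 ∷ [])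
  ∷ (# 1 ∷ # 0 ∷ # 3 ∷ # 2 ∷ # 24 ∷ # 26 ∷ # 28 ∷ # 21 ∷ # 29 ∷ # 25 ∷ # 23 ∷ # 22 ∷ # 27 ∷ # 46 ∷ # 41 ∷ # 39 ∷ # 47 ∷ # 40 ∷ # 42 ∷ # 44 ∷
     # 45 ∷ # 43 ∷ # 62 ∷ # 58 ∷ # 57 ∷ # 59 ∷ # 63 ∷ # 56 ∷ # 60 ∷ # 61 ∷ # 78 ∷ # 76 ∷ # 77 ∷ # 75 ∷ # 72 ∷ # 79 ∷ # 74 ∷ # 73 ∷ [])
  ∷ (# 4 ∷ # 5 ∷ # 6 ∷ # 7 ∷ # 16 ∷ # 17 ∷ # 14 ∷ # 20 ∷ # 12 ∷ # 15 ∷ # 18 ∷ # 19 ∷ # 13 ∷ # 31 ∷ # 37 ∷ # 35 ∷ # 34 ∷ # 30 ∷ # 36 ∷ # 33 ∷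
     # 38 ∷ # 32 ∷ # 61 ∷ # 60 ∷ # 59 ∷ # 62 ∷ # 56 ∷ # 63 ∷ # 58 ∷ # 57 ∷ # 75 ∷ # 74 ∷ # 73 ∷ # 76 ∷ # 79 ∷ # 72 ∷ # 78 ∷ # 77 ∷ [])
  ∷ (# 6 ∷ # 7 ∷ # 4 ∷ # 5 ∷ # 23 ∷ # 24 ∷ # 29 ∷ # 26 ∷ # 28 ∷ # 27 ∷ # 21 ∷ # 25 ∷ # 22 ∷ # 42 ∷ # 44 ∷ # 46 ∷ # 39 ∷ # 47 ∷ # 43 ∷ # 41 ∷
     # 40 ∷ # 45 ∷ # 53 ∷ # 48 ∷ # 54 ∷ # 50 ∷ # 51 ∷ # 55 ∷ # 49 ∷ # 52 ∷ # 64 ∷ # 71 ∷ # 65 ∷ # 66 ∷ # 67 ∷ # 69 ∷ # 70 ∷ # 68 ∷ [])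
  ∷ (# 8 ∷ # 9 ∷ # 10 ∷ # 11 ∷ # 13 ∷ # 19 ∷ # 17 ∷ # 16 ∷ # 18 ∷ # 12 ∷ # 15 ∷ # 20 ∷ # 14 ∷ # 41 ∷ # 42 ∷ # 47 ∷ # 44 ∷ # 46 ∷ # 45 ∷ # 39 ∷
     # 43 ∷ # 40 ∷ # 55 ∷ # 50 ∷ # 51 ∷ # 52 ∷ # 54 ∷ # 49 ∷ # 53 ∷ # 48 ∷ # 77 ∷ # 79 ∷ # 75 ∷ # 78 ∷ # 74 ∷ # 73 ∷ # 76 ∷ # 72 ∷ [])
  ∷ (# 11 ∷ # 10 ∷ # 9 ∷ # 8 ∷ # 28 ∷ # 23 ∷ # 21 ∷ # 29 ∷ # 22 ∷ # 24 ∷ # 26 ∷ # 27 ∷ # 25 ∷ # 34 ∷ # 35 ∷ # 32 ∷ # 38 ∷ # 33 ∷ # 30 ∷ # 36 ∷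
     # 37 ∷ # 31 ∷ # 59 ∷ # 63 ∷ # 61 ∷ # 60 ∷ # 58 ∷ # 57 ∷ # 62 ∷ # 56 ∷ # 69 ∷ # 66 ∷ # 70 ∷ # 67 ∷ # 68 ∷ # 71 ∷ # 65 ∷ # 64 ∷ [])
  ∷ []

colouring38 : HasCompleteColouring (KK 6 38) 80
colouring38 = table⇒hasCompleteColouring table38 _

table39 : Table 6 39 82
table39 =
    (# 0 ∷ # 1 ∷ # 2 ∷ # 3 ∷ # 15 ∷ # 13 ∷ # 12 ∷ # 14 ∷ # 20 ∷ # 16 ∷ # 17 ∷ # 19 ∷ # 18 ∷ # 33 ∷ # 31 ∷ # 34 ∷ # 32 ∷ # 38 ∷ # 30 ∷ # 35 ∷
     # 37 ∷ # 36 ∷ # 56 ∷ # 50 ∷ # 52 ∷ # 55 ∷ # 49 ∷ # 48 ∷ # 53 ∷ # 51 ∷ # 54 ∷ # 69 ∷ # 68 ∷ # 70 ∷ # 67 ∷ # 66 ∷ # 72 ∷ # 73 ∷ # 71 ∷ [])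
  ∷ (# 1 ∷ # 0 ∷ # 3 ∷ # 2 ∷ # 29 ∷ # 23 ∷ # 26 ∷ # 25 ∷ # 24 ∷ # 21 ∷ # 28 ∷ # 27 ∷ # 22 ∷ # 41 ∷ # 47 ∷ # 44 ∷ # 43 ∷ # 42 ∷ # 39 ∷ # 46 ∷
     # 40 ∷ # 45 ∷ # 65 ∷ # 59 ∷ # 62 ∷ # 61 ∷ # 60 ∷ # 57 ∷ # 63 ∷ # 58 ∷ # 64 ∷ # 77 ∷ # 78 ∷ # 74 ∷ # 76 ∷ # 81 ∷ # 75 ∷ # 79 ∷ # 80 ∷ [])
  ∷ (# 4 ∷ # 5 ∷ # 6 ∷ # 7 ∷ # 20 ∷ # 14 ∷ # 17 ∷ # 19 ∷ # 18 ∷ # 12 ∷ # 13 ∷ # 15 ∷ # 16 ∷ # 38 ∷ # 32 ∷ # 35 ∷ # 37 ∷ # 36 ∷ # 34 ∷ # 31 ∷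
     # 33 ∷ # 30 ∷ # 62 ∷ # 65 ∷ # 61 ∷ # 60 ∷ # 57 ∷ # 59 ∷ # 64 ∷ # 63 ∷ # 58 ∷ # 78 ∷ # 77 ∷ # 80 ∷ # 75 ∷ # 79 ∷ # 76 ∷ # 81 ∷ # 74 ∷ [])
  ∷ (# 6 ∷ # 7 ∷ # 4 ∷ # 5 ∷ # 26 ∷ # 29 ∷ # 25 ∷ # 24 ∷ # 21 ∷ # 23 ∷ # 27 ∷ # 22 ∷ # 28 ∷ # 44 ∷ # 41 ∷ # 43 ∷ # 42 ∷ # 39 ∷ # 47 ∷ # 40 ∷
     # 45 ∷ # 46 ∷ # 55 ∷ # 54 ∷ # 53 ∷ # 51 ∷ # 56 ∷ # 52 ∷ # 49 ∷ # 50 ∷ # 48 ∷ # 70 ∷ # 67 ∷ # 73 ∷ # 68 ∷ # 72 ∷ # 66 ∷ # 71 ∷ # 69 ∷ [])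
  ∷ (# 8 ∷ # 9 ∷ # 10 ∷ # 11 ∷ # 19 ∷ # 18 ∷ # 16 ∷ # 15 ∷ # 13 ∷ # 17 ∷ # 20 ∷ # 14 ∷ # 12 ∷ # 47 ∷ # 44 ∷ # 42 ∷ # 46 ∷ # 43 ∷ # 41 ∷ # 45 ∷
     # 39 ∷ # 40 ∷ # 51 ∷ # 49 ∷ # 48 ∷ # 50 ∷ # 54 ∷ # 53 ∷ # 56 ∷ # 55 ∷ # 52 ∷ # 75 ∷ # 80 ∷ # 78 ∷ # 81 ∷ # 74 ∷ # 77 ∷ # 76 ∷ # 79 ∷ [])
  ∷ (# 11 ∷ # 10 ∷ # 9 ∷ # 8 ∷ # 23 ∷ # 26 ∷ # 24 ∷ # 28 ∷ # 25 ∷ # 29 ∷ # 22 ∷ # 21 ∷ # 27 ∷ # 37 ∷ # 36 ∷ # 30 ∷ # 33 ∷ # 31 ∷ # 35 ∷ # 38 ∷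
     # 32 ∷ # 34 ∷ # 59 ∷ # 62 ∷ # 60 ∷ # 64 ∷ # 61 ∷ # 65 ∷ # 58 ∷ # 57 ∷ # 63 ∷ # 71 ∷ # 66 ∷ # 72 ∷ # 69 ∷ # 68 ∷ # 73 ∷ # 70 ∷ # 67 ∷ [])
  ∷ []

colouring39 : HasCompleteColouring (KK 6 39) 82
colouring39 = table⇒hasCompleteColouring table39 _

table40 : Table 6 40 84
table40 =
    (# 0 ∷ # 1 ∷ # 2 ∷ # 3 ∷ # 19 ∷ # 12 ∷ # 18 ∷ # 17 ∷ # 15 ∷ # 13 ∷ # 14 ∷ # 16 ∷ # 20 ∷ # 33 ∷ # 30 ∷ # 34 ∷ # 32 ∷ # 36 ∷ # 37 ∷ # 38 ∷
     # 31 ∷ # 35 ∷ # 48 ∷ # 51 ∷ # 49 ∷ # 56 ∷ # 54 ∷ # 55 ∷ # 53 ∷ # 52 ∷ # 50 ∷ # 73 ∷ # 69 ∷ # 72 ∷ # 68 ∷ # 66 ∷ # 67 ∷ # 71 ∷ # 70 ∷ # 74 ∷ [])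
  ∷ (# 1 ∷ # 0 ∷ # 3 ∷ # 2 ∷ # 22 ∷ # 27 ∷ # 29 ∷ # 21 ∷ # 26 ∷ # 24 ∷ # 28 ∷ # 25 ∷ # 23 ∷ # 41 ∷ # 46 ∷ # 47 ∷ # 43 ∷ # 44 ∷ # 42 ∷ # 45 ∷
     # 39 ∷ # 40 ∷ # 58 ∷ # 64 ∷ # 59 ∷ # 61 ∷ # 57 ∷ # 60 ∷ # 65 ∷ # 63 ∷ # 62 ∷ # 83 ∷ # 81 ∷ # 77 ∷ # 79 ∷ # 80 ∷ # 78 ∷ # 82 ∷ # 75 ∷ # 76 ∷ [])
  ∷ (# 4 ∷ # 5 ∷ # 6 ∷ # 7 ∷ # 12 ∷ # 15 ∷ # 16 ∷ # 14 ∷ # 18 ∷ # 19 ∷ # 20 ∷ # 13 ∷ # 17 ∷ # 30 ∷ # 36 ∷ # 31 ∷ # 38 ∷ # 33 ∷ # 34 ∷ # 35 ∷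
     # 37 ∷ # 32 ∷ # 65 ∷ # 61 ∷ # 58 ∷ # 60 ∷ # 62 ∷ # 64 ∷ # 63 ∷ # 57 ∷ # 59 ∷ # 76 ∷ # 82 ∷ # 83 ∷ # 75 ∷ # 78 ∷ # 80 ∷ # 81 ∷ # 79 ∷ # 77 ∷ [])
  ∷ (# 6 ∷ # 7 ∷ # 4 ∷ # 5 ∷ # 23 ∷ # 25 ∷ # 22 ∷ # 24 ∷ # 21 ∷ # 28 ∷ # 29 ∷ # 27 ∷ # 26 ∷ # 47 ∷ # 43 ∷ # 40 ∷ # 42 ∷ # 39 ∷ # 44 ∷ # 46 ∷
     # 45 ∷ # 41 ∷ # 55 ∷ # 48 ∷ # 54 ∷ # 50 ∷ # 51 ∷ # 52 ∷ # 56 ∷ # 49 ∷ # 53 ∷ # 69 ∷ # 66 ∷ # 70 ∷ # 74 ∷ # 72 ∷ # 73 ∷ # 68 ∷ # 67 ∷ # 71 ∷ [])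
  ∷ (# 8 ∷ # 9 ∷ # 10 ∷ # 11 ∷ # 15 ∷ # 18 ∷ # 13 ∷ # 20 ∷ # 12 ∷ # 16 ∷ # 17 ∷ # 19 ∷ # 14 ∷ # 40 ∷ # 45 ∷ # 41 ∷ # 39 ∷ # 42 ∷ # 46 ∷ # 47 ∷
     # 43 ∷ # 44 ∷ # 51 ∷ # 54 ∷ # 52 ∷ # 53 ∷ # 48 ∷ # 49 ∷ # 50 ∷ # 55 ∷ # 56 ∷ # 77 ∷ # 79 ∷ # 76 ∷ # 78 ∷ # 75 ∷ # 82 ∷ # 83 ∷ # 81 ∷ # 80 ∷ [])
  ∷ (# 11 ∷ # 10 ∷ # 9 ∷ # 8 ∷ # 29 ∷ # 28 ∷ # 23 ∷ # 25 ∷ # 24 ∷ # 26 ∷ # 27 ∷ # 21 ∷ # 22 ∷ # 37 ∷ # 33 ∷ # 36 ∷ # 35 ∷ # 30 ∷ # 31 ∷ # 32 ∷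
     # 34 ∷ # 38 ∷ # 59 ∷ # 63 ∷ # 65 ∷ # 57 ∷ # 60 ∷ # 62 ∷ # 64 ∷ # 61 ∷ # 58 ∷ # 66 ∷ # 72 ∷ # 67 ∷ # 71 ∷ # 69 ∷ # 70 ∷ # 74 ∷ # 73 ∷ # 68 ∷ [])
  ∷ []

colouring40 : HasCompleteColouring (KK 6 40) 84
colouring40 = table⇒hasCompleteColouring table40 _

colourings : All (λ q → HasCompleteColouring (KK 6 q) (2 * q + 4)) (applyUpTo (16 +_) 25)
colourings =
    colouring16 ∷ colouring17 ∷ colouring18 ∷ colouring19 ∷ colouring20
  ∷ colouring21 ∷ colouring22 ∷ colouring23 ∷ colouring24 ∷ colouring25
  ∷ colouring26 ∷ colouring27 ∷ colouring28 ∷ colouring29 ∷ colouring30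
  ∷ colouring31 ∷ colouring32 ∷ colouring33 ∷ colouring34 ∷ colouring35
  ∷ colouring36 ∷ colouring37 ∷ colouring38 ∷ colouring39 ∷ colouring40
  ∷ []

proposition8 : (q : ℕ) → 16 ≤ q → q ≤ 40 → AchrAtLeast (KK 6 q) (2 * q + 4)
proposition8 q 16≤q q≤40 = 2 * q + 4 , ≤-refl , All.lookup colourings (∈-applyUpTo-+ 16≤q (s≤s q≤40))
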